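{- If $T$ is a string of length $n$, randomly generated by a memoryless source over an alphabet of size $\sigma \geq 2$ with identical letter probabilities, then, for any integer $\ell>0$, the expected size of $\mathcal{A}_{\ell}(T)$ is in $\mathcal{O}(\frac{n\log\ell}{\ell\log\sigma}+\frac{n}{\ell})$.
   Context: $T[i..j]$ denotes the fragment $T[i]\ldots T[j]$. Given a string $X$ of length $\ell>0$, the bd-anchor of $X$ is the lexicographically minimal rotation $j\in[1,\ell]$ of $X$ with minimal $j$. The set $\mathcal{A}_{\ell}(T)$ of order-$\ell$ bd-anchors of $T$ is the set of bd-anchors of $T[i..i+\ell-1]$, for all $i\in[1,n-\ell+1]$ (as positions in $T$). -}

module Defs where

open import Data.Nat using (ℕ; zero; suc; _+_; _∸_; _<ᵇ_)
open import Data.Nat.Properties using (_≟_)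
open import Data.Bool using (Bool; true; false; if_then_else_)
open import Data.Fin using (Fin; toℕ)
open import Data.List using (List; []; _∷_; [_]; map; concatMap; allFin; upTo; take; drop; _++_; foldl; length; deduplicate)
open import Data.Nat.ListAction using (sum)
open import Data.Vec using (Vec; toList) renaming ([] to []ᵥ; _∷_ to _∷ᵥ_)

allStrings : (σ n : ℕ) → List (Vec (Fin σ) n)
allStrings σ zero    = [ []ᵥ ]
allStrings σ (suc n) = concatMap (λ a → map (a ∷ᵥ_) (allStrings σ n)) (allFin σ)

_<L_ : List ℕ → List ℕ → Bool
[]       <L []       = false
[]       <L (_ ∷ _)  = true
(_ ∷ _)  <L []       = false
(x ∷ xs) <L (y ∷ ys) = if x <ᵇ y then true else (if y <ᵇ x then false else xs <L ys)

rot : List ℕ → ℕ → List ℕ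
rot X j = drop j X ++ take j X

-- bd-anchor of X (0-indexed): the smallest j in [0, |X|) such that rot X j is
-- lexicographically minimal among all rotations of X.
bdAnchor : List ℕ → ℕ
bdAnchor X = foldl (λ best j → if rot X j <L rot X best then j else best) 0 (upTo (length X))

-- Order-ℓ bd-anchors of T (as a list of positions in T, 0-indexed, possibly with repeats):
-- for each window start i ∈ [0, n-ℓ], the position i + bdAnchor(T[i..i+ℓ-1]).
anchorPositions : ℕ → List ℕ → List ℕ
anchorPositions ℓ T =
  map (λ i → i + bdAnchor (take ℓ (drop i T))) (upTo (suc (length T) ∸ ℓ))

anchorSetSize : ℕ → List ℕ → ℕ
anchorSetSize ℓ T = length (deduplicate _≟_ (anchorPositions ℓ T))

-- Sum over all σ^n strings of length n of |A_ℓ(T)|  (= σ^n · E|A_ℓ(T)|).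
totalAnchors : (σ n ℓ : ℕ) → ℕ
totalAnchors σ n ℓ = sum (map (λ T → anchorSetSize ℓ (map toℕ (toList T))) (allStrings σ n))

-- Fix r with σ ^ r > ℓ (r ≈ log ℓ / log σ) and m + 1 ≈ ℓ / 2r. The bd-anchor a of a window either lies
-- within r of the window's end, or the r-block starting at a is a minimal block of the window, and since the
-- window has length at least (2m + 1) r, it is then no larger than each of m consecutive r-blocks lying entirely on its
-- left or entirely on its right. Anchor counts decrease with the position (rotating a word moves its anchor), so
-- the first case has probability at most 2r/ℓ per window. Ranking the σ ^ r blocks, a fixed block is no larger
-- than m independent ones with probability at most ∑_v (1 − v/σ^r)^m / σ^r ≤ 2/(m + 1). Summing over windows and
-- positions gives ℓ E|A_ℓ(T)| ≤ 18 n r, and r ⌊log₂ σ⌋ ≤ ⌊log₂ ℓ⌋ + ⌊log₂ σ⌋.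

module Submission where

open import Defs
open import Data.Bool using (Bool; true; false; not; _∧_; if_then_else_)
open import Data.Empty using (⊥-elim)
open import Data.Fin using (Fin; toℕ)
open import Data.List using (List; []; _∷_; map; concatMap; tabulate; allFin; upTo; foldl; take; drop; _++_; length; deduplicate)
open import Data.List.Membership.Propositional using (_∈_)
open import Data.List.Membership.Propositional.Properties using (∈-map⁻; ∈-upTo⁻; ∈-deduplicate⁻)
open import Data.List.Properties
  using (length-++; length-take; length-drop; take-[]; take-take; take-drop; drop-drop; take++drop≡id; ++-assoc;
         map-++; map-∘; map-cong; map-tabulate; foldl-∷ʳ; upTo-∷ʳ)
open import Data.List.Relation.Unary.All using (All; []; _∷_)
import Data.List.Relation.Unary.All as All
import Data.List.Relation.Unary.All.Properties as All
open import Data.List.Relation.Unary.AllPairs using ([]; _∷_)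
open import Data.List.Relation.Unary.Any using (here; there)
open import Data.List.Relation.Unary.Unique.Propositional using (Unique)
open import Data.Nat
open import Data.Nat.DivMod using (_/_; _%_; m/n*n≤m; m≡m%n+[m/n]*n; m%n<n)
open import Data.Nat.Induction using (<-wellFounded)
open import Data.Nat.ListAction using (sum)
open import Data.Nat.ListAction.Properties using (sum-++)
open import Data.Nat.Logarithm using (⌊log₂_⌋; ⌊log₂⌋-mono-≤; ⌊log₂[2^n]⌋≡n; ⌊log₂⌊n/2⌋⌋≡⌊log₂n⌋∸1)
open import Data.Nat.Properties
open import Algebra.Properties.CommutativeSemigroup +-commutativeSemigroup using () renaming (interchange to +-interchange)
open import Algebra.Properties.CommutativeSemigroup *-commutativeSemigroup using () renaming (x∙yz≈y∙xz to *-left-comm)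
open import Data.Nat.Tactic.RingSolver using (solve-∀)
open import Data.List.Relation.Unary.Unique.DecPropositional.Properties _≟_ using (deduplicate-!)
open import Data.List.Membership.DecPropositional _≟_ using (_∈?_)
open import Data.Product using (∃-syntax; _×_; _,_)
open import Data.Sum using (_⊎_; inj₁; inj₂; map₁)
open import Data.Vec using (toList) renaming ([] to []ᵥ; _∷_ to _∷ᵥ_)
open import Function using (_∘_)
open import Induction.WellFounded using (Acc; acc)
open import Relation.Binary using (tri<; tri≈; tri>)
open import Relation.Binary.PropositionalEquality
open import Relation.Nullary using (Dec; yes; no; does; ¬_)
open import Relation.Nullary.Decidable using (dec-true; dec-false)

⟦_⟧ : Bool → ℕ
⟦ true  ⟧ = 1
⟦ false ⟧ = 0

⟦∧⟧ : ∀ a b → ⟦ a ∧ b ⟧ ≡ ⟦ a ⟧ * ⟦ b ⟧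
⟦∧⟧ true  b = sym (+-identityʳ ⟦ b ⟧)
⟦∧⟧ false b = refl

⟦false∧⟧ : ∀ {a} b → a ≡ false → ⟦ a ∧ b ⟧ ≡ 0
⟦false∧⟧ b refl = refl

⟦⟧≤1 : ∀ b → ⟦ b ⟧ ≤ 1
⟦⟧≤1 true  = ≤-refl
⟦⟧≤1 false = z≤n

⟦∧⟧≤ : ∀ a b → ⟦ a ∧ b ⟧ ≤ ⟦ b ⟧
⟦∧⟧≤ true  b = ≤-refl
⟦∧⟧≤ false b = z≤n

⟦∧∧⟧≤ : ∀ a b c → ⟦ a ∧ b ∧ c ⟧ ≤ ⟦ c ⟧
⟦∧∧⟧≤ true  b c = ⟦∧⟧≤ b c
⟦∧∧⟧≤ false b c = z≤n

^[n∸m]*^m≡^n : ∀ σ {m n} → m ≤ n → σ ^ (n ∸ m) * σ ^ m ≡ σ ^ n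
^[n∸m]*^m≡^n σ {m} {n} m≤n = trans (sym (^-distribˡ-+-* σ (n ∸ m) m)) (cong (σ ^_) (m∸n+n≡m m≤n))

sumTo : ℕ → (ℕ → ℕ) → ℕ
sumTo zero    f = 0
sumTo (suc k) f = f 0 + sumTo k (f ∘ suc)

infix 5 sumTo
syntax sumTo k (λ i → e) = ∑[ i < k ] e

sumTo-cong : ∀ k {f g : ℕ → ℕ} → (∀ i → i < k → f i ≡ g i) → sumTo k f ≡ sumTo k g
sumTo-cong zero    eq = refl
sumTo-cong (suc k) eq = cong₂ _+_ (eq 0 z<s) (sumTo-cong k (λ i i<k → eq (suc i) (s<s i<k)))

sumTo-mono-≤ : ∀ k {f g : ℕ → ℕ} → (∀ i → i < k → f i ≤ g i) → sumTo k f ≤ sumTo k g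
sumTo-mono-≤ zero    le = z≤n
sumTo-mono-≤ (suc k) le = +-mono-≤ (le 0 z<s) (sumTo-mono-≤ k (λ i i<k → le (suc i) (s<s i<k)))

sumTo-+ : ∀ k (f g : ℕ → ℕ) → ∑[ i < k ] (f i + g i) ≡ sumTo k f + sumTo k g
sumTo-+ zero    f g = refl
sumTo-+ (suc k) f g = begin
  f 0 + g 0 + (∑[ i < k ] f (suc i) + g (suc i))   ≡⟨ cong (f 0 + g 0 +_) (sumTo-+ k (f ∘ suc) (g ∘ suc)) ⟩
  f 0 + g 0 + (sumTo k (f ∘ suc) + sumTo k (g ∘ suc)) ≡⟨ +-interchange (f 0) (g 0) _ _ ⟩
  f 0 + sumTo k (f ∘ suc) + (g 0 + sumTo k (g ∘ suc)) ∎
  where open ≡-Reasoning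

sumTo-*ˡ : ∀ k c (f : ℕ → ℕ) → ∑[ i < k ] (c * f i) ≡ c * sumTo k f
sumTo-*ˡ zero    c f = sym (*-zeroʳ c)
sumTo-*ˡ (suc k) c f = trans (cong (c * f 0 +_) (sumTo-*ˡ k c (f ∘ suc))) (sym (*-distribˡ-+ c (f 0) _))

sumTo-const : ∀ k c → ∑[ i < k ] c ≡ k * c
sumTo-const zero    c = refl
sumTo-const (suc k) c = cong (c +_) (sumTo-const k c)

sumTo-splitAt : ∀ j k (f : ℕ → ℕ) → sumTo (j + k) f ≡ sumTo j f + (∑[ i < k ] f (j + i))
sumTo-splitAt zero    k f = refl
sumTo-splitAt (suc j) k f = trans (cong (f 0 +_) (sumTo-splitAt j k (f ∘ suc))) (sym (+-assoc (f 0) _ _))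

sumTo-* : ∀ k K (f : ℕ → ℕ) → sumTo (k * K) f ≡ ∑[ a < k ] ∑[ v < K ] f (a * K + v)
sumTo-* zero    K f = refl
sumTo-* (suc k) K f = trans (sumTo-splitAt K (k * K) f) (cong (sumTo K f +_) (begin
  ∑[ i < k * K ] f (K + i)                         ≡⟨ sumTo-* k K (λ i → f (K + i)) ⟩
  ∑[ a < k ] ∑[ v < K ] f (K + (a * K + v))        ≡⟨ sumTo-cong k (λ a _ → sumTo-cong K (λ v _ →
                                                        cong f (sym (+-assoc K (a * K) v)))) ⟩
  ∑[ a < k ] ∑[ v < K ] f (suc a * K + v)          ∎))
  where open ≡-Reasoning

term≤sumTo : ∀ k (f : ℕ → ℕ) {i} → i < k → f i ≤ sumTo k f
term≤sumTo (suc k) f {zero}  _         = m≤m+n (f 0) _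
term≤sumTo (suc k) f {suc i} (s<s i<k) = ≤-trans (term≤sumTo k (f ∘ suc) i<k) (m≤n+m _ (f 0))

count-≥ : ∀ N c → ∑[ v < N ] ⟦ not (v <ᵇ c) ⟧ ≡ N ∸ c
count-≥ zero    zero    = refl
count-≥ zero    (suc c) = refl
count-≥ (suc N) zero    = cong suc (trans (sumTo-const N 1) (*-identityʳ N))
count-≥ (suc N) (suc c) = count-≥ N c

sumTo-swap : ∀ j k (f : ℕ → ℕ → ℕ) → ∑[ a < j ] ∑[ b < k ] f a b ≡ ∑[ b < k ] ∑[ a < j ] f a b
sumTo-swap zero    k f = sym (trans (sumTo-const k 0) (*-zeroʳ k))
sumTo-swap (suc j) k f = trans (cong (sumTo k (f 0) +_) (sumTo-swap j k (f ∘ suc)))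
                               (sym (sumTo-+ k (f 0) (λ b → ∑[ a < j ] f (suc a) b)))

take-++-exact : ∀ {A : Set} {k} (u v : List A) → length u ≡ k → take k (u ++ v) ≡ u
take-++-exact []      v refl = refl
take-++-exact (x ∷ u) v refl = cong (x ∷_) (take-++-exact u v refl)

drop-++-exact : ∀ {A : Set} {k} (u v : List A) → length u ≡ k → drop k (u ++ v) ≡ v
drop-++-exact []      v refl = refl
drop-++-exact (x ∷ u) v refl = drop-++-exact u v refl

sum-map-concatMap : ∀ {A B : Set} (g : B → ℕ) (h : A → List B) (xs : List A) →
                    sum (map g (concatMap h xs)) ≡ sum (map (λ x → sum (map g (h x))) xs)
sum-map-concatMap g h []       = refl
sum-map-concatMap g h (x ∷ xs) = begin
  sum (map g (h x ++ concatMap h xs))                ≡⟨ cong sum (map-++ g (h x) _) ⟩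
  sum (map g (h x) ++ map g (concatMap h xs))        ≡⟨ sum-++ (map g (h x)) _ ⟩
  sum (map g (h x)) + sum (map g (concatMap h xs))   ≡⟨ cong (sum (map g (h x)) +_) (sum-map-concatMap g h xs) ⟩
  sum (map g (h x)) + sum (map (λ y → sum (map g (h y))) xs) ∎
  where open ≡-Reasoning

sum-tabulate-toℕ : ∀ k (g : ℕ → ℕ) → sum (tabulate (λ (a : Fin k) → g (toℕ a))) ≡ ∑[ a < k ] g a
sum-tabulate-toℕ zero    g = refl
sum-tabulate-toℕ (suc k) g = cong (g 0 +_) (sum-tabulate-toℕ k (g ∘ suc))

true≢false : true ≢ false
true≢false ()

<ᵇ-≡-true : ∀ {m n} → m < n → (m <ᵇ n) ≡ true
<ᵇ-≡-true {zero}  {suc n} _         = refl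
<ᵇ-≡-true {suc m} {suc n} (s<s m<n) = <ᵇ-≡-true m<n

<ᵇ-≡-false : ∀ {m n} → n ≤ m → (m <ᵇ n) ≡ false
<ᵇ-≡-false {m}     {zero}  _         = refl
<ᵇ-≡-false {suc m} {suc n} (s≤s n≤m) = <ᵇ-≡-false n≤m

<ᵇ-true⇒< : ∀ m n → (m <ᵇ n) ≡ true → m < n
<ᵇ-true⇒< zero    (suc n) _  = z<s
<ᵇ-true⇒< (suc m) (suc n) eq = s<s (<ᵇ-true⇒< m n eq)

<L-∷-< : ∀ {a b} xs ys → a < b → (a ∷ xs) <L (b ∷ ys) ≡ true
<L-∷-< xs ys a<b rewrite <ᵇ-≡-true a<b = refl

<L-∷-> : ∀ {a b} xs ys → b < a → (a ∷ xs) <L (b ∷ ys) ≡ false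
<L-∷-> xs ys b<a rewrite <ᵇ-≡-false (<⇒≤ b<a) | <ᵇ-≡-true b<a = refl

<L-∷-≡ : ∀ a xs ys → (a ∷ xs) <L (a ∷ ys) ≡ xs <L ys
<L-∷-≡ a xs ys rewrite <ᵇ-≡-false (≤-refl {a}) = refl

<L-irrefl : ∀ x → x <L x ≡ false
<L-irrefl []      = refl
<L-irrefl (a ∷ x) = trans (<L-∷-≡ a x x) (<L-irrefl x)

<L-trans : ∀ x y z → x <L y ≡ true → y <L z ≡ true → x <L z ≡ true
<L-trans []      (_ ∷ _) (_ ∷ _) _   _   = refl
<L-trans (_ ∷ _) []      _       x<y _   = ⊥-elim (true≢false (sym x<y))
<L-trans _       (_ ∷ _) []      _   y<z = ⊥-elim (true≢false (sym y<z))
<L-trans (a ∷ x) (b ∷ y) (c ∷ z) x<y y<z with <-cmp a b | <-cmp b c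
... | tri< a<b _ _ | tri< b<c _ _ = <L-∷-< x z (<-trans a<b b<c)
... | tri< a<b _ _ | tri≈ _ refl _ = <L-∷-< x z a<b
... | tri≈ _ refl _ | tri< b<c _ _ = <L-∷-< x z b<c
... | tri≈ _ refl _ | tri≈ _ refl _ =
  trans (<L-∷-≡ a x z) (<L-trans x y z (trans (sym (<L-∷-≡ a x y)) x<y) (trans (sym (<L-∷-≡ a y z)) y<z))
... | _ | tri> _ _ c<b = ⊥-elim (true≢false (trans (sym y<z) (<L-∷-> y z c<b)))
... | tri> _ _ b<a | _ = ⊥-elim (true≢false (trans (sym x<y) (<L-∷-> x y b<a)))

≮L-antisym : ∀ x y → length x ≡ length y → x <L y ≡ false → y <L x ≡ false → x ≡ y
≮L-antisym []      []      _   _   _   = refl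
≮L-antisym (a ∷ x) (b ∷ y) len x≮y y≮x with <-cmp a b
... | tri< a<b _ _ = ⊥-elim (true≢false (trans (sym (<L-∷-< x y a<b)) x≮y))
... | tri> _ _ b<a = ⊥-elim (true≢false (trans (sym (<L-∷-< y x b<a)) y≮x))
... | tri≈ _ refl _ = cong (a ∷_) (≮L-antisym x y (suc-injective len)
                                     (trans (sym (<L-∷-≡ a x y)) x≮y) (trans (sym (<L-∷-≡ a y x)) y≮x))

<L-≮L-trans : ∀ x y z → length y ≡ length z → x <L y ≡ true → z <L y ≡ false → x <L z ≡ true
<L-≮L-trans x y z len x<y z≮y with y <L z in y<z
... | true  = <L-trans x y z x<y y<z
... | false with ≮L-antisym y z len y<z z≮y
... | refl  = x<y

≮L-<L-trans : ∀ x y z → z <L y ≡ false → x <L y ≡ true → z <L x ≡ false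
≮L-<L-trans x y z z≮y x<y with z <L x in z<x
... | false = refl
... | true  = ⊥-elim (true≢false (trans (sym (<L-trans z x y z<x x<y)) z≮y))

<L-take⁻ : ∀ r x y → r ≤ length x → r ≤ length y → take r x <L take r y ≡ true → x <L y ≡ true
<L-take⁻ zero    x       y       _         _         eq = ⊥-elim (true≢false (sym eq))
<L-take⁻ (suc r) (a ∷ x) (b ∷ y) (s≤s r≤x) (s≤s r≤y) eq with <-cmp a b
... | tri< a<b _ _ = <L-∷-< x y a<b
... | tri> _ _ b<a = ⊥-elim (true≢false (trans (sym eq) (<L-∷-> (take r x) (take r y) b<a)))
... | tri≈ _ refl _ =
  trans (<L-∷-≡ a x y) (<L-take⁻ r x y r≤x r≤y (trans (sym (<L-∷-≡ a (take r x) (take r y))) eq))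

≮L-take : ∀ r x y → r ≤ length x → r ≤ length y → x <L y ≡ false → take r x <L take r y ≡ false
≮L-take r x y r≤x r≤y x≮y with take r x <L take r y in eq
... | false = refl
... | true  = ⊥-elim (true≢false (trans (sym (<L-take⁻ r x y r≤x r≤y eq)) x≮y))

-- Rotations and bd-anchors

length-take-≤ : ∀ {A : Set} j (X : List A) → j ≤ length X → length (take j X) ≡ j
length-take-≤ j X j≤X = trans (length-take j X) (m≤n⇒m⊓n≡m j≤X)

take-++ˡ : ∀ {A : Set} j (X Y : List A) → j ≤ length X → take j (X ++ Y) ≡ take j X
take-++ˡ zero    X       Y _         = refl
take-++ˡ (suc j) (x ∷ X) Y (s≤s j≤X) = cong (x ∷_) (take-++ˡ j X Y j≤X)

drop-++ˡ : ∀ {A : Set} j (X Y : List A) → j ≤ length X → drop j (X ++ Y) ≡ drop j X ++ Y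
drop-++ˡ zero    X       Y _         = refl
drop-++ˡ (suc j) (x ∷ X) Y (s≤s j≤X) = drop-++ˡ j X Y j≤X

take-length-+-++ : ∀ {A : Set} d (X Y : List A) → take (length X + d) (X ++ Y) ≡ X ++ take d Y
take-length-+-++ d []      Y = refl
take-length-+-++ d (x ∷ X) Y = cong (x ∷_) (take-length-+-++ d X Y)

drop-length-+-++ : ∀ {A : Set} d (X Y : List A) → drop (length X + d) (X ++ Y) ≡ drop d Y
drop-length-+-++ d []      Y = refl
drop-length-+-++ d (x ∷ X) Y = drop-length-+-++ d X Y

take-+ : ∀ {A : Set} c j (X : List A) → take (c + j) X ≡ take c X ++ take j (drop c X)
take-+ zero    j X       = refl
take-+ (suc c) j []      = sym (take-[] j)
take-+ (suc c) j (x ∷ X) = cong (x ∷_) (take-+ c j X)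

drop-take-++-drop : ∀ {A : Set} d c (X : List A) → d ≤ c → drop d X ≡ drop d (take c X) ++ drop c X
drop-take-++-drop zero    c       X       _         = sym (take++drop≡id c X)
drop-take-++-drop (suc d) (suc c) []      _         = refl
drop-take-++-drop (suc d) (suc c) (x ∷ X) (s≤s d≤c) = drop-take-++-drop d c X d≤c

take-take-≤ : ∀ {A : Set} d c (X : List A) → d ≤ c → take d (take c X) ≡ take d X
take-take-≤ d c X d≤c = trans (take-take d c X) (cong (λ k → take k X) (m≤n⇒m⊓n≡m d≤c))

length-rot : ∀ X j → length (rot X j) ≡ length X
length-rot X j = begin
  length (drop j X ++ take j X)               ≡⟨ length-++ (drop j X) ⟩
  length (drop j X) + length (take j X)       ≡⟨ cong₂ _+_ (length-drop j X) (length-take j X) ⟩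
  (length X ∸ j) + j ⊓ length X               ≡⟨ +-comm (length X ∸ j) _ ⟩
  j ⊓ length X + (length X ∸ j)               ≡⟨ m⊓n+n∸m≡n j (length X) ⟩
  length X                                    ∎
  where open ≡-Reasoning

rot-rot : ∀ X c j → c + j ≤ length X → rot (rot X c) j ≡ rot X (c + j)
rot-rot X c j c+j≤X = begin
  drop j (drop c X ++ take c X) ++ take j (drop c X ++ take c X)
    ≡⟨ cong₂ _++_ (drop-++ˡ j (drop c X) (take c X) j≤) (take-++ˡ j (drop c X) (take c X) j≤) ⟩
  (drop j (drop c X) ++ take c X) ++ take j (drop c X)
    ≡⟨ ++-assoc (drop j (drop c X)) (take c X) (take j (drop c X)) ⟩
  drop j (drop c X) ++ (take c X ++ take j (drop c X))
    ≡⟨ cong₂ _++_ (drop-drop c j X) (sym (take-+ c j X)) ⟩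
  drop (c + j) X ++ take (c + j) X ∎
  where
  open ≡-Reasoning
  j≤ : j ≤ length (drop c X)
  j≤ = subst (j ≤_) (sym (length-drop c X)) (subst (_≤ length X ∸ c) (m+n∸m≡n c j) (∸-monoˡ-≤ c c+j≤X))

rot-rot-wrap : ∀ X c d → c ≤ length X → d ≤ c → rot (rot X c) ((length X ∸ c) + d) ≡ rot X d
rot-rot-wrap X c d c≤X d≤c = begin
  drop (length X ∸ c + d) (drop c X ++ take c X) ++ take (length X ∸ c + d) (drop c X ++ take c X)
    ≡⟨ cong (λ k → drop (k + d) (drop c X ++ take c X) ++ take (k + d) (drop c X ++ take c X)) (sym (length-drop c X)) ⟩
  drop (length (drop c X) + d) (drop c X ++ take c X) ++ take (length (drop c X) + d) (drop c X ++ take c X)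
    ≡⟨ cong₂ _++_ (drop-length-+-++ d (drop c X) (take c X)) (take-length-+-++ d (drop c X) (take c X)) ⟩
  drop d (take c X) ++ (drop c X ++ take d (take c X))
    ≡⟨ ++-assoc (drop d (take c X)) (drop c X) _ ⟨
  (drop d (take c X) ++ drop c X) ++ take d (take c X)
    ≡⟨ cong₂ _++_ (sym (drop-take-++-drop d c X d≤c)) (take-take-≤ d c X d≤c) ⟩
  drop d X ++ take d X ∎
  where open ≡-Reasoning

rot-rot-isRot : ∀ X c j → c ≤ length X → j < length X → ∃[ d ] d < length X × rot (rot X c) j ≡ rot X d
rot-rot-isRot X c j c≤X j<X with c + j <? length X
... | yes c+j<X = c + j , c+j<X , rot-rot X c j (<⇒≤ c+j<X)
... | no  c+j≮X = d , <-≤-trans d<c c≤X , trans (cong (rot (rot X c)) j≡L∸c+d) (rot-rot-wrap X c d c≤X (<⇒≤ d<c))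
  where
  open ≡-Reasoning
  L = length X
  L≤c+j = ≮⇒≥ c+j≮X
  d = c + j ∸ L
  d<c : d < c
  d<c = subst (d <_) (m+n∸n≡m c L) (∸-monoˡ-< (+-monoʳ-< c j<X) L≤c+j)
  j≡L∸c+d : j ≡ (L ∸ c) + d
  j≡L∸c+d = +-cancelˡ-≡ c _ _ (begin
    c + j               ≡⟨ m+[n∸m]≡n L≤c+j ⟨
    L + d               ≡⟨ cong (_+ d) (m+[n∸m]≡n c≤X) ⟨
    c + (L ∸ c) + d     ≡⟨ +-assoc c (L ∸ c) d ⟩
    c + (L ∸ c + d)     ∎)

record IsBdAnchor (X : List ℕ) (a : ℕ) : Set where
  field
    <length  : a < length X
    minimal  : ∀ j → j < length X → rot X j <L rot X a ≡ false
    leftmost : ∀ j → j < a → rot X a <L rot X j ≡ true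

Scanned : List ℕ → ℕ → ℕ → Set
Scanned X k b = (b < k ⊎ b ≡ 0) × (∀ j → j < k → rot X j <L rot X b ≡ false) × (∀ j → j < b → rot X b <L rot X j ≡ true)

scan-step : List ℕ → ℕ → ℕ → ℕ
scan-step X best j = if rot X j <L rot X best then j else best

scanned-step : ∀ X k b → Scanned X k b → Scanned X (suc k) (scan-step X b k)
scanned-step X k b (b<k , min , left) with rot X k <L rot X b in k<b
... | true  = inj₁ ≤-refl , min′ , left′
  where
  min′ : ∀ j → j < suc k → rot X j <L rot X k ≡ false
  min′ j j<1+k with m<1+n⇒m<n∨m≡n j<1+k
  ... | inj₁ j<k  = ≮L-<L-trans (rot X k) (rot X b) (rot X j) (min j j<k) k<b
  ... | inj₂ refl = <L-irrefl (rot X j)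
  left′ : ∀ j → j < k → rot X k <L rot X j ≡ true
  left′ j j<k = <L-≮L-trans (rot X k) (rot X b) (rot X j) (trans (length-rot X b) (sym (length-rot X j))) k<b (min j j<k)
... | false = map₁ m<n⇒m<1+n b<k , min′ , left
  where
  min′ : ∀ j → j < suc k → rot X j <L rot X b ≡ false
  min′ j j<1+k with m<1+n⇒m<n∨m≡n j<1+k
  ... | inj₁ j<k  = min j j<k
  ... | inj₂ refl = k<b

scanned-foldl : ∀ X k → Scanned X k (foldl (scan-step X) 0 (upTo k))
scanned-foldl X zero    = inj₂ refl , (λ _ ()) , (λ _ ())
scanned-foldl X (suc k) = subst (Scanned X (suc k)) foldl-upTo (scanned-step X k _ (scanned-foldl X k))
  where
  foldl-upTo : scan-step X (foldl (scan-step X) 0 (upTo k)) k ≡ foldl (scan-step X) 0 (upTo (suc k))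
  foldl-upTo = trans (sym (foldl-∷ʳ (scan-step X) 0 k (upTo k))) (cong (foldl (scan-step X) 0) (upTo-∷ʳ k))

bdAnchor-isBdAnchor : ∀ X → 0 < length X → IsBdAnchor X (bdAnchor X)
bdAnchor-isBdAnchor X 0<X with scanned-foldl X (length X)
... | inj₁ a<X  , min , left = record { <length = a<X ; minimal = min ; leftmost = left }
... | inj₂ a≡0 , min , left = record { <length = subst (_< length X) (sym a≡0) 0<X ; minimal = min ; leftmost = left }

isBdAnchor-unique : ∀ {X a b} → IsBdAnchor X a → IsBdAnchor X b → a ≡ b
isBdAnchor-unique {a = a} {b} A B with <-cmp a b
... | tri≈ _ a≡b _ = a≡b
... | tri< a<b _ _ = ⊥-elim (true≢false (trans (sym (IsBdAnchor.leftmost B a a<b)) (IsBdAnchor.minimal A b (IsBdAnchor.<length B))))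
... | tri> _ _ b<a = ⊥-elim (true≢false (trans (sym (IsBdAnchor.leftmost A b b<a)) (IsBdAnchor.minimal B a (IsBdAnchor.<length A))))

bdAnchor-< : ∀ X → 0 < length X → bdAnchor X < length X
bdAnchor-< X 0<X = IsBdAnchor.<length (bdAnchor-isBdAnchor X 0<X)

bdAnchor-rot : ∀ X c → 0 < length X → c ≤ bdAnchor X → bdAnchor (rot X c) ≡ bdAnchor X ∸ c
bdAnchor-rot X c 0<X c≤a =
  isBdAnchor-unique (bdAnchor-isBdAnchor Y (subst (0 <_) (sym (length-rot X c)) 0<X)) (record
    { <length  = subst (a ∸ c <_) (sym (length-rot X c)) (≤-<-trans (m∸n≤m a c) a<X)
    ; minimal  = minimal
    ; leftmost = leftmost })
  where
  open IsBdAnchor (bdAnchor-isBdAnchor X 0<X) renaming (minimal to minimalX; leftmost to leftmostX; <length to a<X)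
  a = bdAnchor X
  Y = rot X c
  c≤X : c ≤ length X
  c≤X = ≤-trans c≤a (<⇒≤ a<X)
  c+[a∸c]≡a : c + (a ∸ c) ≡ a
  c+[a∸c]≡a = m+[n∸m]≡n c≤a
  rotY-a∸c : rot Y (a ∸ c) ≡ rot X a
  rotY-a∸c = trans (rot-rot X c (a ∸ c) (subst (_≤ length X) (sym c+[a∸c]≡a) (<⇒≤ a<X))) (cong (rot X) c+[a∸c]≡a)
  minimal : ∀ j → j < length Y → rot Y j <L rot Y (a ∸ c) ≡ false
  minimal j j<Y with rot-rot-isRot X c j c≤X (subst (j <_) (length-rot X c) j<Y)
  ... | d , d<X , rotY-j = trans (cong₂ _<L_ rotY-j rotY-a∸c) (minimalX d d<X)
  leftmost : ∀ j → j < a ∸ c → rot Y (a ∸ c) <L rot Y j ≡ true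
  leftmost j j<a∸c = trans (cong₂ _<L_ rotY-a∸c (rot-rot X c j (<⇒≤ (<-trans c+j<a a<X)))) (leftmostX (c + j) c+j<a)
    where
    c+j<a : c + j < a
    c+j<a = subst (c + j <_) c+[a∸c]≡a (+-monoʳ-< c j<a∸c)

binomial-two-terms≤ : ∀ m N → suc m * N ^ m + N ^ suc m ≤ suc N ^ suc m
binomial-two-terms≤ zero    N = ≤-refl
binomial-two-terms≤ (suc m) N = begin
  suc (suc m) * (N * X) + N * (N * X)              ≤⟨ m≤m+n _ (suc m * X) ⟩
  suc (suc m) * (N * X) + N * (N * X) + suc m * X  ≡⟨ expand m N X ⟩
  suc N * (suc m * X + N * X)                      ≤⟨ *-monoʳ-≤ (suc N) (binomial-two-terms≤ m N) ⟩
  suc N * suc N ^ suc m                            ∎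
  where
  open ≤-Reasoning
  X = N ^ m
  expand : ∀ m N X → suc (suc m) * (N * X) + N * (N * X) + suc m * X ≡ suc N * (suc m * X + N * X)
  expand = solve-∀

powerTailSum : ℕ → ℕ → ℕ
powerTailSum m N = ∑[ v < N ] (N ∸ v) ^ m

powerTailSum-≤ : ∀ m N → suc m * powerTailSum m N ≤ N ^ suc m + suc m * N ^ m
powerTailSum-≤ m zero    = ≤-trans (≤-reflexive (*-zeroʳ (suc m))) z≤n
powerTailSum-≤ m (suc N) = begin
  suc m * (suc N ^ m + powerTailSum m N)                ≡⟨ *-distribˡ-+ (suc m) (suc N ^ m) _ ⟩
  suc m * suc N ^ m + suc m * powerTailSum m N          ≤⟨ +-monoʳ-≤ (suc m * suc N ^ m) (powerTailSum-≤ m N) ⟩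
  suc m * suc N ^ m + (N ^ suc m + suc m * N ^ m)       ≡⟨ cong (suc m * suc N ^ m +_) (+-comm (N ^ suc m) _) ⟩
  suc m * suc N ^ m + (suc m * N ^ m + N ^ suc m)       ≤⟨ +-monoʳ-≤ (suc m * suc N ^ m) (binomial-two-terms≤ m N) ⟩
  suc m * suc N ^ m + suc N ^ suc m                     ≡⟨ +-comm (suc m * suc N ^ m) _ ⟩
  suc N ^ suc m + suc m * suc N ^ m                     ∎
  where open ≤-Reasoning

powerTailSum-≤-2* : ∀ m N → suc m ≤ N → suc m * powerTailSum m N ≤ 2 * N ^ suc m
powerTailSum-≤-2* m N m<N = ≤-trans (powerTailSum-≤ m N) (+-monoʳ-≤ (N ^ suc m) (begin
  suc m * N ^ m        ≤⟨ *-monoˡ-≤ (N ^ m) m<N ⟩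
  N * N ^ m            ≡⟨ +-identityʳ _ ⟨
  N ^ suc m + 0        ∎))
  where open ≤-Reasoning

δ : ℕ → ℕ → ℕ
δ a b = ⟦ does (a ≟ b) ⟧

δ-refl : ∀ a → δ a a ≡ 1
δ-refl a = cong ⟦_⟧ (dec-true (a ≟ a) refl)

sumTo-δ≤1 : ∀ k a → ∑[ b < k ] δ a b ≤ 1
sumTo-δ≤1 zero    a       = z≤n
sumTo-δ≤1 (suc k) zero    = ≤-reflexive (cong suc (trans (sumTo-cong k (λ _ _ → refl)) (trans (sumTo-const k 0) (*-zeroʳ k))))
sumTo-δ≤1 (suc k) (suc a) = sumTo-δ≤1 k a

⟦does⟧-≤ : ∀ {P : Set} (P? : Dec P) {x} → (P → 1 ≤ x) → ⟦ does P? ⟧ ≤ x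
⟦does⟧-≤ (yes p) 1≤x = 1≤x p
⟦does⟧-≤ (no _)  _   = z≤n

⟦does⟧-mono : ∀ {P Q : Set} (P? : Dec P) (Q? : Dec Q) → (P → Q) → ⟦ does P? ⟧ ≤ ⟦ does Q? ⟧
⟦does⟧-mono P? Q? P⇒Q = ⟦does⟧-≤ P? (λ p → ≤-reflexive (sym (cong ⟦_⟧ (dec-true Q? (P⇒Q p)))))

does-false⇒¬ : ∀ {P : Set} (P? : Dec P) → does P? ≡ false → ¬ P
does-false⇒¬ (no ¬p) _ = ¬p

∧-true : ∀ {a b} → a ≡ true → b ≡ true → a ∧ b ≡ true
∧-true refl refl = refl

length-unique≤ : ∀ n ys → Unique ys → All (_< n) ys → length ys ≤ ∑[ p < n ] ⟦ does (p ∈? ys) ⟧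
length-unique≤ n []       _          _            = z≤n
length-unique≤ n (y ∷ ys) (y∉ys ∷ u) (y<n ∷ ys<n) = begin
  1 + length ys
    ≤⟨ +-mono-≤ (subst (_≤ ∑[ p < n ] δ y p) (δ-refl y) (term≤sumTo n (δ y) y<n)) (length-unique≤ n ys u ys<n) ⟩
  (∑[ p < n ] δ y p) + (∑[ p < n ] ⟦ does (p ∈? ys) ⟧)
    ≡⟨ sumTo-+ n (δ y) _ ⟨
  ∑[ p < n ] δ y p + ⟦ does (p ∈? ys) ⟧
    ≤⟨ sumTo-mono-≤ n (λ p _ → disjoint p (y ≟ p)) ⟩
  ∑[ p < n ] ⟦ does (p ∈? (y ∷ ys)) ⟧ ∎
  where
  open ≤-Reasoning
  disjoint : ∀ p → Dec (y ≡ p) → δ y p + ⟦ does (p ∈? ys) ⟧ ≤ ⟦ does (p ∈? (y ∷ ys)) ⟧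
  disjoint p (yes refl) = ≤-reflexive (begin-equality
    δ y y + ⟦ does (y ∈? ys) ⟧      ≡⟨ cong₂ _+_ (δ-refl y) (cong ⟦_⟧ (dec-false (y ∈? ys) (λ y∈ys → All.lookup y∉ys y∈ys refl))) ⟩
    1                              ≡⟨ cong ⟦_⟧ (dec-true (y ∈? (y ∷ ys)) (here refl)) ⟨
    ⟦ does (y ∈? (y ∷ ys)) ⟧       ∎)
  disjoint p (no y≢p) = begin
    δ y p + ⟦ does (p ∈? ys) ⟧     ≡⟨ cong (_+ ⟦ does (p ∈? ys) ⟧) (cong ⟦_⟧ (dec-false (y ≟ p) y≢p)) ⟩
    ⟦ does (p ∈? ys) ⟧             ≤⟨ ⟦does⟧-mono (p ∈? ys) (p ∈? (y ∷ ys)) there ⟩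
    ⟦ does (p ∈? (y ∷ ys)) ⟧       ∎

length-deduplicate≤ : ∀ n xs → All (_< n) xs → length (deduplicate _≟_ xs) ≤ ∑[ p < n ] ⟦ does (p ∈? xs) ⟧
length-deduplicate≤ n xs xs<n = ≤-trans
  (length-unique≤ n (deduplicate _≟_ xs) (deduplicate-! xs) (All.deduplicate⁺ _≟_ xs<n))
  (sumTo-mono-≤ n (λ p _ → ⟦does⟧-mono (p ∈? deduplicate _≟_ xs) (p ∈? xs) (∈-deduplicate⁻ _≟_ xs)))

-- Each distinct value is good or attained at a bad index.
length-deduplicate-map≤ : ∀ n K (f : ℕ → ℕ) (good : ℕ → ℕ) (bad : ℕ → Bool) → (∀ i → i < K → f i < n) →
  (∀ i → i < K → bad i ≡ false → 1 ≤ good (f i)) →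
  length (deduplicate _≟_ (map f (upTo K))) ≤ (∑[ p < n ] good p) + (∑[ i < K ] ⟦ bad i ⟧)
length-deduplicate-map≤ n K f good bad f<n good-f = begin
  length (deduplicate _≟_ xs)
    ≤⟨ length-deduplicate≤ n xs (All.map⁺ (All.tabulate (λ i∈ → f<n _ (∈-upTo⁻ i∈)))) ⟩
  ∑[ p < n ] ⟦ does (p ∈? xs) ⟧
    ≤⟨ sumTo-mono-≤ n (λ p _ → ⟦does⟧-≤ (p ∈? xs) (good-or-bad p)) ⟩
  ∑[ p < n ] good p + (∑[ i < K ] ⟦ bad i ⟧ * δ (f i) p)
    ≡⟨ sumTo-+ n good _ ⟩
  (∑[ p < n ] good p) + (∑[ p < n ] ∑[ i < K ] ⟦ bad i ⟧ * δ (f i) p)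
    ≡⟨ cong ((∑[ p < n ] good p) +_) (sumTo-swap n K (λ p i → ⟦ bad i ⟧ * δ (f i) p)) ⟩
  (∑[ p < n ] good p) + (∑[ i < K ] ∑[ p < n ] ⟦ bad i ⟧ * δ (f i) p)
    ≤⟨ +-monoʳ-≤ (∑[ p < n ] good p) (sumTo-mono-≤ K (λ i _ → once i)) ⟩
  (∑[ p < n ] good p) + (∑[ i < K ] ⟦ bad i ⟧) ∎
  where
  open ≤-Reasoning
  xs = map f (upTo K)
  once : ∀ i → ∑[ p < n ] ⟦ bad i ⟧ * δ (f i) p ≤ ⟦ bad i ⟧
  once i = begin
    ∑[ p < n ] ⟦ bad i ⟧ * δ (f i) p   ≡⟨ sumTo-*ˡ n ⟦ bad i ⟧ (δ (f i)) ⟩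
    ⟦ bad i ⟧ * (∑[ p < n ] δ (f i) p) ≤⟨ *-monoʳ-≤ ⟦ bad i ⟧ (sumTo-δ≤1 n (f i)) ⟩
    ⟦ bad i ⟧ * 1                      ≡⟨ *-identityʳ _ ⟩
    ⟦ bad i ⟧                          ∎
  good-or-bad : ∀ p → p ∈ xs → 1 ≤ good p + (∑[ i < K ] ⟦ bad i ⟧ * δ (f i) p)
  good-or-bad p p∈ with ∈-map⁻ f p∈
  ... | i , i∈ , refl with bad i in bad-i
  ...   | true  = ≤-trans (≤-trans (≤-reflexive (sym (trans (cong (λ b → ⟦ b ⟧ * δ (f i) (f i)) bad-i) (cong (_+ 0) (δ-refl (f i))))))
                                   (term≤sumTo K (λ j → ⟦ bad j ⟧ * δ (f j) (f i)) (∈-upTo⁻ i∈)))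
                          (m≤n+m _ (good (f i)))
  ...   | false = ≤-trans (good-f i (∈-upTo⁻ i∈) bad-i) (m≤m+n _ _)

take-drop-take : ∀ {A : Set} b r L (Z : List A) → b + r ≤ L → take r (drop b (take L Z)) ≡ take r (drop b Z)
take-drop-take zero    r L       Z       r≤L       = take-take-≤ r L Z r≤L
take-drop-take (suc b) r (suc L) []      _         = refl
take-drop-take (suc b) r (suc L) (z ∷ Z) (s≤s b+r≤L) = take-drop-take b r L Z b+r≤L

length-window : ∀ ℓ i (T : List ℕ) → i + ℓ ≤ length T → length (take ℓ (drop i T)) ≡ ℓ
length-window ℓ i T i+ℓ≤T = length-take-≤ ℓ (drop i T)
  (subst (ℓ ≤_) (sym (length-drop i T)) (subst (_≤ length T ∸ i) (m+n∸m≡n i ℓ) (∸-monoˡ-≤ i i+ℓ≤T)))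

window-fits : ∀ n ℓ i → i < suc n ∸ ℓ → i + ℓ ≤ n
window-fits n ℓ i i<K = ≤-pred (m≤o∸n⇒m+n≤o (suc i) ℓ≤1+n i<K)
  where
  ℓ≤1+n : ℓ ≤ suc n
  ℓ≤1+n = <⇒≤ (m∸n≢0⇒n<m (λ 1+n∸ℓ≡0 → <⇒≢ (<-≤-trans z<s i<K) (sym 1+n∸ℓ≡0)))

anchor-< : ∀ ℓ T i → 0 < ℓ → i < suc (length T) ∸ ℓ → i + bdAnchor (take ℓ (drop i T)) < length T
anchor-< ℓ T i 0<ℓ i<K = <-≤-trans (+-monoʳ-< i a<ℓ) i+ℓ≤T
  where
  i+ℓ≤T = window-fits (length T) ℓ i i<K
  X = take ℓ (drop i T)
  |X|≡ℓ = length-window ℓ i T i+ℓ≤T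
  a<ℓ = subst (bdAnchor X <_) |X|≡ℓ (bdAnchor-< X (subst (0 <_) (sym |X|≡ℓ) 0<ℓ))

anchorSetSize-≤-length : ∀ ℓ T → 0 < ℓ → anchorSetSize ℓ T ≤ length T
anchorSetSize-≤-length ℓ T 0<ℓ = begin
  anchorSetSize ℓ T
    ≤⟨ length-deduplicate-map≤ n K _ (λ _ → 1) (λ _ → false) (λ i → anchor-< ℓ T i 0<ℓ) (λ _ _ _ → ≤-refl) ⟩
  (∑[ p < n ] 1) + (∑[ i < K ] 0)
    ≡⟨ cong₂ _+_ (trans (sumTo-const n 1) (*-identityʳ n)) (trans (sumTo-const K 0) (*-zeroʳ K)) ⟩
  n + 0
    ≡⟨ +-identityʳ n ⟩
  n ∎
  where
  open ≤-Reasoning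
  n = length T
  K = suc n ∸ ℓ

-- Block minima

blocks≥ : ℕ → List ℕ → ℕ → List ℕ → Bool
blocks≥ r x zero    ys = true
blocks≥ r x (suc m) ys = not (take r ys <L x) ∧ blocks≥ r x m (drop r ys)

blocks≥-intro : ∀ r x m ys → (∀ k → k < m → take r (drop (k * r) ys) <L x ≡ false) → blocks≥ r x m ys ≡ true
blocks≥-intro r x zero    ys _     = refl
blocks≥-intro r x (suc m) ys k-th rewrite k-th 0 z<s =
  blocks≥-intro r x m (drop r ys) (λ k k<m → trans (cong (λ z → take r z <L x) (drop-drop r (k * r) ys)) (k-th (suc k) (s<s k<m)))

nearEnd : ℕ → ℕ → List ℕ → Bool
nearEnd ℓ r X = does (ℓ <? bdAnchor X + r)

module BlockMinima (r m : ℕ) where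

  block : List ℕ → ℕ → List ℕ
  block T p = take r (drop p T)

  leftBlockMin : ℕ → List ℕ → Bool
  leftBlockMin p T = does (m * r ≤? p) ∧ does (p + r ≤? length T) ∧ blocks≥ r (block T p) m (take (m * r) (drop (p ∸ m * r) T))

  rightBlockMin : ℕ → List ℕ → Bool
  rightBlockMin p T = does (p + r + m * r ≤? length T) ∧ blocks≥ r (block T p) m (take (m * r) (drop (p + r) T))

  module _ (ℓ : ℕ) (T : List ℕ) (i : ℕ) (i+ℓ≤T : i + ℓ ≤ length T) (0<r : 0 < r) (2mr+r≤ℓ : m * r + m * r + r ≤ ℓ) where

    private
      X = take ℓ (drop i T)
      a = bdAnchor X
      |X|≡ℓ : length X ≡ ℓ
      |X|≡ℓ = length-window ℓ i T i+ℓ≤T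
      0<ℓ : 0 < ℓ
      0<ℓ = <-≤-trans 0<r (≤-trans (m≤n+m r _) 2mr+r≤ℓ)
      open IsBdAnchor (bdAnchor-isBdAnchor X (subst (0 <_) (sym |X|≡ℓ) 0<ℓ))
      within : ∀ {c} → c ≤ ℓ → i + c ≤ length T
      within c≤ℓ = ≤-trans (+-monoʳ-≤ i c≤ℓ) i+ℓ≤T

    block-rot : ∀ c → c + r ≤ ℓ → take r (rot X c) ≡ block T (i + c)
    block-rot c c+r≤ℓ = begin
      take r (drop c X ++ take c X)   ≡⟨ take-++ˡ r (drop c X) (take c X) r≤ ⟩
      take r (drop c X)               ≡⟨ take-drop-take c r ℓ (drop i T) c+r≤ℓ ⟩
      take r (drop c (drop i T))      ≡⟨ cong (take r) (drop-drop i c T) ⟩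
      block T (i + c)                 ∎
      where
      open ≡-Reasoning
      r≤ : r ≤ length (drop c X)
      r≤ = subst (r ≤_) (sym (trans (length-drop c X) (cong (_∸ c) |X|≡ℓ)))
                 (subst (_≤ ℓ ∸ c) (m+n∸m≡n c r) (∸-monoˡ-≤ c c+r≤ℓ))

    block-anchor-minimal : a + r ≤ ℓ → ∀ b → b + r ≤ ℓ → block T (i + b) <L block T (i + a) ≡ false
    block-anchor-minimal a+r≤ℓ b b+r≤ℓ = subst₂ (λ u v → u <L v ≡ false) (block-rot b b+r≤ℓ) (block-rot a a+r≤ℓ)
      (≮L-take r (rot X b) (rot X a) (r≤|rot| b b+r≤ℓ) (r≤|rot| a a+r≤ℓ)
               (minimal b (subst (b <_) (sym |X|≡ℓ) (<-≤-trans (m<m+n b 0<r) b+r≤ℓ))))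
      where
      r≤|rot| : ∀ c → c + r ≤ ℓ → r ≤ length (rot X c)
      r≤|rot| c c+r≤ℓ = subst (r ≤_) (sym (trans (length-rot X c) |X|≡ℓ)) (≤-trans (m≤n+m r c) c+r≤ℓ)

    blocks-in-window : a + r ≤ ℓ → ∀ b → b + m * r ≤ ℓ → blocks≥ r (block T (i + a)) m (take (m * r) (drop (i + b) T)) ≡ true
    blocks-in-window a+r≤ℓ b b+mr≤ℓ = blocks≥-intro r _ m _ (λ k k<m →
      trans (cong (_<L block T (i + a)) (k-th-block k k<m)) (block-anchor-minimal a+r≤ℓ (b + k * r) (b+kr+r≤ℓ k k<m)))
      where
      kr+r≤mr : ∀ k → k < m → k * r + r ≤ m * r
      kr+r≤mr k k<m = ≤-trans (≤-reflexive (+-comm (k * r) r)) (*-monoˡ-≤ r k<m)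
      k-th-block : ∀ k → k < m → take r (drop (k * r) (take (m * r) (drop (i + b) T))) ≡ block T (i + (b + k * r))
      k-th-block k k<m = trans (take-drop-take (k * r) r (m * r) _ (kr+r≤mr k k<m))
                               (trans (cong (take r) (drop-drop (i + b) (k * r) T)) (cong (block T) (+-assoc i b (k * r))))
      b+kr+r≤ℓ : ∀ k → k < m → b + k * r + r ≤ ℓ
      b+kr+r≤ℓ k k<m = ≤-trans (≤-reflexive (+-assoc b (k * r) r)) (≤-trans (+-monoʳ-≤ b (kr+r≤mr k k<m)) b+mr≤ℓ)

    -- A long enough window has m whole blocks on one side of its anchor.
    anchor-blockMin : a + r ≤ ℓ → 1 ≤ ⟦ leftBlockMin (i + a) T ⟧ + ⟦ rightBlockMin (i + a) T ⟧
    anchor-blockMin a+r≤ℓ with m * r ≤? a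
    ... | yes mr≤a = ≤-trans (≤-reflexive (sym (cong ⟦_⟧ isLeft))) (m≤m+n _ _)
      where
      left-blocks-fit : (a ∸ m * r) + m * r ≤ ℓ
      left-blocks-fit = ≤-trans (≤-reflexive (m∸n+n≡m mr≤a)) (≤-trans (m≤m+n a r) a+r≤ℓ)
      isLeft : leftBlockMin (i + a) T ≡ true
      isLeft = ∧-true (dec-true (m * r ≤? i + a) (≤-trans mr≤a (m≤n+m a i)))
              (∧-true (dec-true (i + a + r ≤? length T) (≤-trans (≤-reflexive (+-assoc i a r)) (within a+r≤ℓ)))
                      (subst (λ q → blocks≥ r (block T (i + a)) m (take (m * r) (drop q T)) ≡ true) (sym (+-∸-assoc i mr≤a))
                             (blocks-in-window a+r≤ℓ (a ∸ m * r) left-blocks-fit)))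
    ... | no mr≰a = ≤-trans (≤-reflexive (sym (cong ⟦_⟧ isRight))) (m≤n+m _ _)
      where
      right-blocks-fit : a + r + m * r ≤ ℓ
      right-blocks-fit = ≤-trans (+-monoˡ-≤ (m * r) (+-monoˡ-≤ r (<⇒≤ (≰⇒> mr≰a)))) (≤-trans (≤-reflexive (reorder (m * r) r)) 2mr+r≤ℓ)
        where
        reorder : ∀ x r → x + r + x ≡ x + x + r
        reorder = solve-∀
      isRight : rightBlockMin (i + a) T ≡ true
      isRight = ∧-true (dec-true (i + a + r + m * r ≤? length T) (≤-trans (≤-reflexive (regroup i a r (m * r))) (within right-blocks-fit)))
                       (subst (λ q → blocks≥ r (block T (i + a)) m (take (m * r) (drop q T)) ≡ true) (sym (+-assoc i a r))
                              (blocks-in-window a+r≤ℓ (a + r) right-blocks-fit))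
        where
        regroup : ∀ i a r x → i + a + r + x ≡ i + (a + r + x)
        regroup = solve-∀

  anchorSetSize-≤ : ∀ ℓ T → 0 < r → m * r + m * r + r ≤ ℓ →
    anchorSetSize ℓ T ≤ (∑[ p < length T ] ⟦ leftBlockMin p T ⟧ + ⟦ rightBlockMin p T ⟧)
                       + (∑[ i < suc (length T) ∸ ℓ ] ⟦ nearEnd ℓ r (take ℓ (drop i T)) ⟧)
  anchorSetSize-≤ ℓ T 0<r 2mr+r≤ℓ = length-deduplicate-map≤ (length T) (suc (length T) ∸ ℓ) _ _ _
    (λ i → anchor-< ℓ T i 0<ℓ)
    (λ i i<K notNear → anchor-blockMin ℓ T i (window-fits (length T) ℓ i i<K) 0<r 2mr+r≤ℓ
                         (≮⇒≥ (does-false⇒¬ (ℓ <? _ + r) notNear)))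
    where
    0<ℓ : 0 < ℓ
    0<ℓ = <-≤-trans 0<r (≤-trans (m≤n+m r _) 2mr+r≤ℓ)

module _ (σ : ℕ) where

  -- Sum n f is σ ^ n times the expectation of f over uniformly random words of length n over [0, σ).
  Sum : ℕ → (List ℕ → ℕ) → ℕ
  Sum zero    f = f []
  Sum (suc n) f = ∑[ a < σ ] Sum n (λ w → f (a ∷ w))

  IsWord : ℕ → List ℕ → Set
  IsWord n w = length w ≡ n × All (_< σ) w

  Sum-cong : ∀ n {f g : List ℕ → ℕ} → (∀ w → IsWord n w → f w ≡ g w) → Sum n f ≡ Sum n g
  Sum-cong zero    eq = eq [] (refl , [])
  Sum-cong (suc n) eq = sumTo-cong σ (λ a a<σ → Sum-cong n (λ w (len , all) → eq (a ∷ w) (cong suc len , a<σ ∷ all)))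

  Sum-mono-≤ : ∀ n {f g : List ℕ → ℕ} → (∀ w → IsWord n w → f w ≤ g w) → Sum n f ≤ Sum n g
  Sum-mono-≤ zero    le = le [] (refl , [])
  Sum-mono-≤ (suc n) le = sumTo-mono-≤ σ (λ a a<σ → Sum-mono-≤ n (λ w (len , all) → le (a ∷ w) (cong suc len , a<σ ∷ all)))

  Sum-const : ∀ n c → Sum n (λ _ → c) ≡ σ ^ n * c
  Sum-const zero    c = sym (+-identityʳ c)
  Sum-const (suc n) c = begin
    ∑[ a < σ ] Sum n (λ _ → c)  ≡⟨ sumTo-cong σ (λ _ _ → Sum-const n c) ⟩
    ∑[ a < σ ] (σ ^ n * c)      ≡⟨ sumTo-const σ (σ ^ n * c) ⟩
    σ * (σ ^ n * c)             ≡⟨ *-assoc σ (σ ^ n) c ⟨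
    σ ^ suc n * c               ∎
    where open ≡-Reasoning

  Sum-*ˡ : ∀ n c (f : List ℕ → ℕ) → Sum n (λ w → c * f w) ≡ c * Sum n f
  Sum-*ˡ zero    c f = refl
  Sum-*ˡ (suc n) c f = trans (sumTo-cong σ (λ a _ → Sum-*ˡ n c (λ w → f (a ∷ w)))) (sumTo-*ˡ σ c _)

  Sum-+ : ∀ n (f g : List ℕ → ℕ) → Sum n (λ w → f w + g w) ≡ Sum n f + Sum n g
  Sum-+ zero    f g = refl
  Sum-+ (suc n) f g = trans (sumTo-cong σ (λ a _ → Sum-+ n (λ w → f (a ∷ w)) (λ w → g (a ∷ w)))) (sumTo-+ σ _ _)

  Sum-sumTo : ∀ n k (f : ℕ → List ℕ → ℕ) → Sum n (λ w → ∑[ i < k ] f i w) ≡ ∑[ i < k ] Sum n (f i)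
  Sum-sumTo zero    k f = refl
  Sum-sumTo (suc n) k f = trans (sumTo-cong σ (λ a _ → Sum-sumTo n k (λ i w → f i (a ∷ w))))
                                (sumTo-swap σ k (λ a i → Sum n (λ w → f i (a ∷ w))))

  Sum-swap : ∀ j k (f : List ℕ → List ℕ → ℕ) → Sum j (λ u → Sum k (f u)) ≡ Sum k (λ v → Sum j (λ u → f u v))
  Sum-swap zero    k f = refl
  Sum-swap (suc j) k f = trans (sumTo-cong σ (λ a _ → Sum-swap j k (λ u → f (a ∷ u))))
                               (sym (Sum-sumTo k σ (λ a v → Sum j (λ u → f (a ∷ u) v))))

  Sum-++ : ∀ j k (f : List ℕ → ℕ) → Sum (j + k) f ≡ Sum j (λ u → Sum k (λ v → f (u ++ v)))
  Sum-++ zero    k f = refl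
  Sum-++ (suc j) k f = sumTo-cong σ (λ a _ → Sum-++ j k (λ w → f (a ∷ w)))

  sum-allStrings : ∀ n (F : List ℕ → ℕ) → sum (map (λ T → F (map toℕ (toList T))) (allStrings σ n)) ≡ Sum n F
  sum-allStrings zero    F = +-identityʳ (F [])
  sum-allStrings (suc n) F = begin
    sum (map G (concatMap (λ a → map (a ∷ᵥ_) (allStrings σ n)) (allFin σ)))
      ≡⟨ sum-map-concatMap G _ (allFin σ) ⟩
    sum (map (λ a → sum (map G (map (a ∷ᵥ_) (allStrings σ n)))) (allFin σ))
      ≡⟨ cong sum (map-cong (λ a → trans (cong sum (sym (map-∘ (allStrings σ n))))
                                        (sum-allStrings n (λ w → F (toℕ a ∷ w)))) (allFin σ)) ⟩
    sum (map (λ a → Sum n (λ w → F (toℕ a ∷ w))) (allFin σ))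
      ≡⟨ cong sum (map-tabulate {n = σ} (λ a → a) (λ a → Sum n (λ w → F (toℕ a ∷ w)))) ⟩
    sum (tabulate (λ (a : Fin σ) → Sum n (λ w → F (toℕ a ∷ w))))
      ≡⟨ sum-tabulate-toℕ σ (λ a → Sum n (λ w → F (a ∷ w))) ⟩
    Sum (suc n) F ∎
    where
    open ≡-Reasoning
    G = λ T → F (map toℕ (toList T))

  Sum-window : ∀ n s L (g : List ℕ → ℕ) → s + L ≤ n → Sum n (λ T → g (take L (drop s T))) ≡ σ ^ (n ∸ L) * Sum L g
  Sum-window n s L g s+L≤n = begin
    Sum n (λ T → g (take L (drop s T)))
      ≡⟨ cong (λ k → Sum k (λ T → g (take L (drop s T)))) n≡s+L+t ⟩
    Sum (s + (L + t)) (λ T → g (take L (drop s T)))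
      ≡⟨ Sum-++ s (L + t) _ ⟩
    Sum s (λ u → Sum (L + t) (λ v → g (take L (drop s (u ++ v)))))
      ≡⟨ Sum-cong s (λ u (|u| , _) → trans (Sum-++ L t _) (Sum-cong L (λ v (|v| , _) → Sum-cong t (λ z _ →
           cong g (window-++ u v z |u| |v|))))) ⟩
    Sum s (λ _ → Sum L (λ v → Sum t (λ _ → g v)))
      ≡⟨ Sum-const s _ ⟩
    σ ^ s * Sum L (λ v → Sum t (λ _ → g v))
      ≡⟨ cong (σ ^ s *_) (trans (Sum-cong L (λ v _ → Sum-const t (g v))) (Sum-*ˡ L (σ ^ t) g)) ⟩
    σ ^ s * (σ ^ t * Sum L g)
      ≡⟨ *-assoc (σ ^ s) (σ ^ t) _ ⟨
    σ ^ s * σ ^ t * Sum L g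
      ≡⟨ cong (_* Sum L g) (trans (sym (^-distribˡ-+-* σ s t)) (cong (σ ^_) s+t≡n∸L)) ⟩
    σ ^ (n ∸ L) * Sum L g ∎
    where
    open ≡-Reasoning
    t = n ∸ (s + L)
    n≡s+L+t : n ≡ s + (L + t)
    n≡s+L+t = trans (sym (m+[n∸m]≡n s+L≤n)) (+-assoc s L t)
    s+t≡n∸L : s + t ≡ n ∸ L
    s+t≡n∸L = sym (begin
      n ∸ L                ≡⟨ cong (_∸ L) n≡s+L+t ⟩
      s + (L + t) ∸ L      ≡⟨ cong (λ k → s + k ∸ L) (+-comm L t) ⟩
      s + (t + L) ∸ L      ≡⟨ cong (_∸ L) (+-assoc s t L) ⟨
      s + t + L ∸ L        ≡⟨ m+n∸n≡m (s + t) L ⟩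
      s + t                ∎)
    window-++ : ∀ u v z → length u ≡ s → length v ≡ L → take L (drop s (u ++ (v ++ z))) ≡ v
    window-++ u v z |u| |v| = trans (cong (take L) (drop-++-exact u (v ++ z) |u|)) (take-++-exact v z |v|)

  -- Probability of a block minimum

  value : List ℕ → ℕ
  value []      = 0
  value (a ∷ w) = a * σ ^ length w + value w

  value< : ∀ r w → IsWord r w → value w < σ ^ r
  value< zero    []      _                 = z<s
  value< (suc r) (a ∷ w) (refl , a<σ ∷ w<σ) = begin-strict
    a * σ ^ length w + value w       <⟨ +-monoʳ-< (a * σ ^ length w) (value< (length w) w (refl , w<σ)) ⟩
    a * σ ^ length w + σ ^ length w  ≡⟨ +-comm (a * σ ^ length w) _ ⟩
    suc a * σ ^ length w             ≤⟨ *-monoˡ-≤ (σ ^ length w) a<σ ⟩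
    σ * σ ^ length w                 ∎
    where open ≤-Reasoning

  value-<⇒<L : ∀ r x y → IsWord r x → IsWord r y → value y < value x → y <L x ≡ true
  value-<⇒<L (suc r) (a ∷ x) (b ∷ y) (refl , _ ∷ x<σ) (|y| , b<σ ∷ y<σ) vy<vx with <-cmp b a
  ... | tri< b<a _ _ = <L-∷-< y x b<a
  ... | tri≈ _ refl _ = trans (<L-∷-≡ b y x)
        (value-<⇒<L (length x) x y (refl , x<σ) (|y|′ , y<σ) (+-cancelˡ-< (b * σ ^ length x) (value y) (value x) vy<vx′))
    where
    |y|′ = suc-injective |y|
    vy<vx′ : b * σ ^ length x + value y < b * σ ^ length x + value x
    vy<vx′ = subst (λ k → b * σ ^ k + value y < b * σ ^ length x + value x) |y|′ vy<vx
  ... | tri> _ _ a<b = ⊥-elim (<-asym vy<vx (begin-strict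
    a * σ ^ length x + value x        <⟨ +-monoʳ-< (a * σ ^ length x) (value< (length x) x (refl , x<σ)) ⟩
    a * σ ^ length x + σ ^ length x   ≡⟨ +-comm (a * σ ^ length x) _ ⟩
    suc a * σ ^ length x              ≤⟨ *-monoˡ-≤ (σ ^ length x) a<b ⟩
    b * σ ^ length x                  ≤⟨ m≤m+n (b * σ ^ length x) (value y) ⟩
    b * σ ^ length x + value y        ≡⟨ cong (λ k → b * σ ^ k + value y) (suc-injective |y|) ⟨
    b * σ ^ length y + value y        ∎))
    where open ≤-Reasoning

  Sum-value : ∀ r (h : ℕ → ℕ) → Sum r (λ y → h (value y)) ≡ ∑[ v < σ ^ r ] h v
  Sum-value zero    h = sym (+-identityʳ (h 0))
  Sum-value (suc r) h = begin
    ∑[ a < σ ] Sum r (λ w → h (a * σ ^ length w + value w))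
      ≡⟨ sumTo-cong σ (λ a _ → Sum-cong r (λ w (|w| , _) → cong (λ k → h (a * σ ^ k + value w)) |w|)) ⟩
    ∑[ a < σ ] Sum r (λ w → h (a * σ ^ r + value w))
      ≡⟨ sumTo-cong σ (λ a _ → Sum-value r (λ v → h (a * σ ^ r + v))) ⟩
    ∑[ a < σ ] ∑[ v < σ ^ r ] h (a * σ ^ r + v)
      ≡⟨ sumTo-* σ (σ ^ r) h ⟨
    sumTo (σ * σ ^ r) h ∎
    where open ≡-Reasoning

  module _ (r : ℕ) where

    #≥ : List ℕ → ℕ
    #≥ x = Sum r (λ y → ⟦ not (y <L x) ⟧)

    Sum-blocks≥ : ∀ m x → Sum (m * r) (λ ys → ⟦ blocks≥ r x m ys ⟧) ≡ #≥ x ^ m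
    Sum-blocks≥ zero    x = refl
    Sum-blocks≥ (suc m) x = begin
      Sum (r + m * r) (λ ys → ⟦ blocks≥ r x (suc m) ys ⟧)
        ≡⟨ Sum-++ r (m * r) _ ⟩
      Sum r (λ u → Sum (m * r) (λ v → ⟦ not (take r (u ++ v) <L x) ∧ blocks≥ r x m (drop r (u ++ v)) ⟧))
        ≡⟨ Sum-cong r (λ u (|u| , _) → Sum-cong (m * r) (λ v _ → split u v |u|)) ⟩
      Sum r (λ u → Sum (m * r) (λ v → ⟦ not (u <L x) ⟧ * ⟦ blocks≥ r x m v ⟧))
        ≡⟨ Sum-cong r (λ u _ → trans (Sum-*ˡ (m * r) ⟦ not (u <L x) ⟧ _) (cong (⟦ not (u <L x) ⟧ *_) (Sum-blocks≥ m x))) ⟩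
      Sum r (λ u → ⟦ not (u <L x) ⟧ * #≥ x ^ m)
        ≡⟨ trans (Sum-cong r (λ u _ → *-comm ⟦ not (u <L x) ⟧ _)) (Sum-*ˡ r (#≥ x ^ m) _) ⟩
      #≥ x ^ m * #≥ x
        ≡⟨ *-comm (#≥ x ^ m) (#≥ x) ⟩
      #≥ x ^ suc m ∎
      where
      open ≡-Reasoning
      split : ∀ u v → length u ≡ r →
              ⟦ not (take r (u ++ v) <L x) ∧ blocks≥ r x m (drop r (u ++ v)) ⟧ ≡ ⟦ not (u <L x) ⟧ * ⟦ blocks≥ r x m v ⟧
      split u v |u| rewrite take-++-exact u v |u| | drop-++-exact u v |u| = ⟦∧⟧ (not (u <L x)) _

    #≥-≤ : ∀ x → IsWord r x → #≥ x ≤ σ ^ r ∸ value x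
    #≥-≤ x x-word = begin
      Sum r (λ y → ⟦ not (y <L x) ⟧)                  ≤⟨ Sum-mono-≤ r (λ y y-word → below y y-word) ⟩
      Sum r (λ y → ⟦ not (value y <ᵇ value x) ⟧)      ≡⟨ Sum-value r (λ v → ⟦ not (v <ᵇ value x) ⟧) ⟩
      ∑[ v < σ ^ r ] ⟦ not (v <ᵇ value x) ⟧           ≡⟨ count-≥ (σ ^ r) (value x) ⟩
      σ ^ r ∸ value x                                 ∎
      where
      open ≤-Reasoning
      below : ∀ y → IsWord r y → ⟦ not (y <L x) ⟧ ≤ ⟦ not (value y <ᵇ value x) ⟧
      below y y-word with value y <ᵇ value x in vy<vx
      ... | false = ⟦⟧≤1 _
      ... | true rewrite value-<⇒<L r x y x-word y-word (<ᵇ-true⇒< (value y) (value x) vy<vx) = z≤n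

    minBlockCount : ℕ → ℕ
    minBlockCount m = Sum r (λ x → Sum (m * r) (λ ys → ⟦ blocks≥ r x m ys ⟧))

    minBlockCount-≤ : ∀ m → suc m ≤ σ ^ r → suc m * minBlockCount m ≤ 2 * σ ^ (m * r + r)
    minBlockCount-≤ m m<σ^r = begin
      suc m * minBlockCount m
        ≤⟨ *-monoʳ-≤ (suc m) (Sum-mono-≤ r (λ x x-word →
             ≤-trans (≤-reflexive (Sum-blocks≥ m x)) (^-monoˡ-≤ m (#≥-≤ x x-word)))) ⟩
      suc m * Sum r (λ x → (σ ^ r ∸ value x) ^ m)
        ≡⟨ cong (suc m *_) (Sum-value r (λ v → (σ ^ r ∸ v) ^ m)) ⟩
      suc m * powerTailSum m (σ ^ r)
        ≤⟨ powerTailSum-≤-2* m (σ ^ r) m<σ^r ⟩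
      2 * (σ ^ r) ^ suc m
        ≡⟨ cong (2 *_) (trans (^-*-assoc σ r (suc m)) (cong (σ ^_) (trans (*-comm r (suc m)) (+-comm r (m * r))))) ⟩
      2 * σ ^ (m * r + r) ∎
      where open ≤-Reasoning

  -- Distribution of the bd-anchor

  Sum-rot : ∀ L c (f : List ℕ → ℕ) → c ≤ L → Sum L (λ X → f (rot X c)) ≡ Sum L f
  Sum-rot L c f c≤L = begin
    Sum L (λ X → f (rot X c))                          ≡⟨ cong (λ k → Sum k (λ X → f (rot X c))) (sym c+d≡L) ⟩
    Sum (c + d) (λ X → f (rot X c))                    ≡⟨ Sum-++ c d _ ⟩
    Sum c (λ u → Sum d (λ v → f (rot (u ++ v) c)))     ≡⟨ Sum-cong c (λ u (|u| , _) → Sum-cong d (λ v _ → cong f (rot-++ u v |u|))) ⟩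
    Sum c (λ u → Sum d (λ v → f (v ++ u)))             ≡⟨ Sum-swap c d (λ u v → f (v ++ u)) ⟩
    Sum d (λ v → Sum c (λ u → f (v ++ u)))             ≡⟨ Sum-++ d c f ⟨
    Sum (d + c) f                                      ≡⟨ cong (λ k → Sum k f) (trans (+-comm d c) c+d≡L) ⟩
    Sum L f                                            ∎
    where
    open ≡-Reasoning
    d = L ∸ c
    c+d≡L = m+[n∸m]≡n c≤L
    rot-++ : ∀ u v → length u ≡ c → rot (u ++ v) c ≡ v ++ u
    rot-++ u v |u| = cong₂ _++_ (drop-++-exact u v |u|) (take-++-exact u v |u|)

  #anchorAt : ℕ → ℕ → ℕ
  #anchorAt L a = Sum L (λ X → δ (bdAnchor X) a)

  -- Rotation by a − a′ permutes the words and turns anchor a into anchor a′.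
  #anchorAt-antitone : ∀ L a a′ → 0 < L → a < L → a′ ≤ a → #anchorAt L a ≤ #anchorAt L a′
  #anchorAt-antitone L a a′ 0<L a<L a′≤a = begin
    Sum L (λ X → δ (bdAnchor X) a)                   ≤⟨ Sum-mono-≤ L (λ X (|X| , _) → ⟦does⟧-≤ (bdAnchor X ≟ a) (shifted X |X|)) ⟩
    Sum L (λ X → δ (bdAnchor (rot X (a ∸ a′))) a′)   ≡⟨ Sum-rot L (a ∸ a′) (λ Y → δ (bdAnchor Y) a′) (≤-trans (m∸n≤m a a′) (<⇒≤ a<L)) ⟩
    Sum L (λ X → δ (bdAnchor X) a′)                  ∎
    where
    open ≤-Reasoning
    shifted : ∀ X → length X ≡ L → bdAnchor X ≡ a → 1 ≤ δ (bdAnchor (rot X (a ∸ a′))) a′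
    shifted X |X| refl = ≤-reflexive (sym (trans (cong (λ b → δ b a′) rotated) (δ-refl a′)))
      where
      rotated : bdAnchor (rot X (a ∸ a′)) ≡ a′
      rotated = trans (bdAnchor-rot X (a ∸ a′) (subst (0 <_) (sym |X|) 0<L) (m∸n≤m a a′)) (m∸[m∸n]≡n a′≤a)

  #anchorAt-≤ : ∀ L a → 0 < L → a < L → suc a * #anchorAt L a ≤ σ ^ L
  #anchorAt-≤ L a 0<L a<L = begin
    suc a * #anchorAt L a                        ≡⟨ sumTo-const (suc a) (#anchorAt L a) ⟨
    ∑[ a′ < suc a ] #anchorAt L a                ≤⟨ sumTo-mono-≤ (suc a) (λ a′ a′<1+a →
                                                      #anchorAt-antitone L a a′ 0<L a<L (m<1+n⇒m≤n a′<1+a)) ⟩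
    ∑[ a′ < suc a ] #anchorAt L a′               ≡⟨ Sum-sumTo L (suc a) (λ a′ X → δ (bdAnchor X) a′) ⟨
    Sum L (λ X → ∑[ a′ < suc a ] δ (bdAnchor X) a′)  ≤⟨ Sum-mono-≤ L (λ X _ → sumTo-δ≤1 (suc a) (bdAnchor X)) ⟩
    Sum L (λ _ → 1)                              ≡⟨ trans (Sum-const L 1) (*-identityʳ _) ⟩
    σ ^ L                                        ∎
    where open ≤-Reasoning

  nearEnd≤ : ∀ L r X → length X ≡ L → 0 < L → ⟦ nearEnd L r X ⟧ ≤ ∑[ j < r ] δ (bdAnchor X) (L ∸ suc j)
  nearEnd≤ L r X |X| 0<L = ⟦does⟧-≤ (L <? b + r) (λ L<b+r →
    ≤-trans (≤-reflexive (sym (trans (cong (δ b) (L∸1+j≡b)) (δ-refl b)))) (term≤sumTo r (λ j → δ b (L ∸ suc j)) (j<r L<b+r)))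
    where
    b = bdAnchor X
    b<L : b < L
    b<L = subst (b <_) |X| (bdAnchor-< X (subst (0 <_) (sym |X|) 0<L))
    j = L ∸ suc b
    j<r : L < b + r → j < r
    j<r L<b+r = +-cancelˡ-< b j r (subst (_≤ b + r) (sym (m+[n∸m]≡n b<L)) (<⇒≤ L<b+r))
    L∸1+j≡b : L ∸ suc j ≡ b
    L∸1+j≡b = begin
      L ∸ suc j            ≡⟨ cong (_∸ suc j) (m+[n∸m]≡n b<L) ⟨
      suc b + j ∸ suc j    ≡⟨ cong (_∸ suc j) (sym (+-suc b j)) ⟩
      b + suc j ∸ suc j    ≡⟨ m+n∸n≡m b (suc j) ⟩
      b                    ∎
      where open ≡-Reasoning

  -- Anchor counts decrease with the position, so each of the last r ≤ L/2 positions gets at most a 2/L share.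
  nearEnd-count : ∀ L r → 0 < L → 2 * r ≤ L → L * Sum L (λ X → ⟦ nearEnd L r X ⟧) ≤ r * (2 * σ ^ L)
  nearEnd-count L r 0<L 2r≤L = begin
    L * Sum L (λ X → ⟦ nearEnd L r X ⟧)
      ≤⟨ *-monoʳ-≤ L (Sum-mono-≤ L (λ X (|X| , _) → nearEnd≤ L r X |X| 0<L)) ⟩
    L * Sum L (λ X → ∑[ j < r ] δ (bdAnchor X) (L ∸ suc j))
      ≡⟨ cong (L *_) (Sum-sumTo L r (λ j X → δ (bdAnchor X) (L ∸ suc j))) ⟩
    L * (∑[ j < r ] #anchorAt L (L ∸ suc j))
      ≡⟨ sumTo-*ˡ r L _ ⟨
    ∑[ j < r ] L * #anchorAt L (L ∸ suc j)
      ≤⟨ sumTo-mono-≤ r (λ j j<r → late j j<r) ⟩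
    ∑[ j < r ] 2 * σ ^ L
      ≡⟨ sumTo-const r _ ⟩
    r * (2 * σ ^ L) ∎
    where
    open ≤-Reasoning
    late : ∀ j → j < r → L * #anchorAt L (L ∸ suc j) ≤ 2 * σ ^ L
    late j j<r = begin
      L * #anchorAt L a                ≤⟨ *-monoˡ-≤ (#anchorAt L a) L≤2[L∸j] ⟩
      2 * (L ∸ j) * #anchorAt L a      ≡⟨ cong (λ z → 2 * z * #anchorAt L a) 1+a≡L∸j ⟨
      2 * suc a * #anchorAt L a        ≡⟨ *-assoc 2 (suc a) (#anchorAt L a) ⟩
      2 * (suc a * #anchorAt L a)      ≤⟨ *-monoʳ-≤ 2 (#anchorAt-≤ L a 0<L a<L) ⟩
      2 * σ ^ L                        ∎
      where
      a = L ∸ suc j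
      j+j≤L : j + j ≤ L
      j+j≤L = ≤-trans (+-mono-≤ (<⇒≤ j<r) (<⇒≤ j<r)) (subst (_≤ L) (cong (r +_) (+-identityʳ r)) 2r≤L)
      j<L : j < L
      j<L = <-≤-trans j<r (≤-trans (m≤m+n r (r + 0)) 2r≤L)
      1+a≡L∸j : suc a ≡ L ∸ j
      1+a≡L∸j = sym (+-∸-assoc 1 j<L)
      a<L : a < L
      a<L = subst (_≤ L) (sym 1+a≡L∸j) (m∸n≤m L j)
      L≤2[L∸j] : L ≤ 2 * (L ∸ j)
      L≤2[L∸j] = begin
        L                 ≡⟨ m+[n∸m]≡n (<⇒≤ j<L) ⟨
        j + (L ∸ j)       ≤⟨ +-monoˡ-≤ (L ∸ j) (+-cancelˡ-≤ j j (L ∸ j) (subst (j + j ≤_) (sym (m+[n∸m]≡n (<⇒≤ j<L))) j+j≤L)) ⟩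
        (L ∸ j) + (L ∸ j) ≡⟨ cong ((L ∸ j) +_) (+-identityʳ (L ∸ j)) ⟨
        2 * (L ∸ j)       ∎

  Sum-window-≤ : ∀ n s L c (f g : List ℕ → ℕ) → s + L ≤ n → (∀ T → IsWord n T → f T ≤ g (take L (drop s T))) →
                 c * Sum L g ≤ 2 * σ ^ L → c * Sum n f ≤ 2 * σ ^ n
  Sum-window-≤ n s L c f g s+L≤n f≤g bound = begin
    c * Sum n f                                 ≤⟨ *-monoʳ-≤ c (Sum-mono-≤ n f≤g) ⟩
    c * Sum n (λ T → g (take L (drop s T)))     ≡⟨ cong (c *_) (Sum-window n s L g s+L≤n) ⟩
    c * (σ ^ (n ∸ L) * Sum L g)                 ≡⟨ *-left-comm c (σ ^ (n ∸ L)) (Sum L g) ⟩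
    σ ^ (n ∸ L) * (c * Sum L g)                 ≤⟨ *-monoʳ-≤ (σ ^ (n ∸ L)) bound ⟩
    σ ^ (n ∸ L) * (2 * σ ^ L)                   ≡⟨ *-left-comm (σ ^ (n ∸ L)) 2 (σ ^ L) ⟩
    2 * (σ ^ (n ∸ L) * σ ^ L)                   ≡⟨ cong (2 *_) (^[n∸m]*^m≡^n σ L≤n) ⟩
    2 * σ ^ n                                   ∎
    where
    open ≤-Reasoning
    L≤n = ≤-trans (m≤n+m L s) s+L≤n

  Sum-zero-≤ : ∀ n c (f : List ℕ → ℕ) → (∀ T → IsWord n T → f T ≡ 0) → c * Sum n f ≤ 2 * σ ^ n
  Sum-zero-≤ n c f f≡0 = ≤-trans (≤-reflexive (begin-equality
    c * Sum n f           ≡⟨ cong (c *_) (Sum-cong n f≡0) ⟩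
    c * Sum n (λ _ → 0)   ≡⟨ cong (c *_) (trans (Sum-const n 0) (*-zeroʳ (σ ^ n))) ⟩
    c * 0                 ≡⟨ *-zeroʳ c ⟩
    0                     ∎)) z≤n
    where open ≤-Reasoning

  nearEnd-part : ∀ n ℓ r → 0 < ℓ → 2 * r ≤ ℓ →
    ℓ * Sum n (λ T → ∑[ i < suc (length T) ∸ ℓ ] ⟦ nearEnd ℓ r (take ℓ (drop i T)) ⟧) ≤ n * (2 * (r * σ ^ n))
  nearEnd-part n ℓ r 0<ℓ 2r≤ℓ = begin
    ℓ * Sum n (λ T → ∑[ i < suc (length T) ∸ ℓ ] W i T)
      ≡⟨ cong (ℓ *_) (Sum-cong n (λ T (|T| , _) → cong (λ k → ∑[ i < suc k ∸ ℓ ] W i T) |T|)) ⟩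
    ℓ * Sum n (λ T → ∑[ i < K ] W i T)
      ≡⟨ cong (ℓ *_) (Sum-sumTo n K W) ⟩
    ℓ * (∑[ i < K ] Sum n (W i))
      ≡⟨ sumTo-*ˡ K ℓ _ ⟨
    ∑[ i < K ] ℓ * Sum n (W i)
      ≤⟨ sumTo-mono-≤ K (λ i i<K → per-window i (window-fits n ℓ i i<K)) ⟩
    ∑[ i < K ] 2 * (r * σ ^ n)
      ≡⟨ sumTo-const K _ ⟩
    K * (2 * (r * σ ^ n))
      ≤⟨ *-monoˡ-≤ (2 * (r * σ ^ n)) (∸-monoʳ-≤ (suc n) 0<ℓ) ⟩
    n * (2 * (r * σ ^ n)) ∎
    where
    open ≤-Reasoning
    K = suc n ∸ ℓ
    W : ℕ → List ℕ → ℕ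
    W i T = ⟦ nearEnd ℓ r (take ℓ (drop i T)) ⟧
    per-window : ∀ i → i + ℓ ≤ n → ℓ * Sum n (W i) ≤ 2 * (r * σ ^ n)
    per-window i i+ℓ≤n = begin
      ℓ * Sum n (W i)                                     ≡⟨ cong (ℓ *_) (Sum-window n i ℓ (λ X → ⟦ nearEnd ℓ r X ⟧) i+ℓ≤n) ⟩
      ℓ * (σ ^ (n ∸ ℓ) * Sum ℓ (λ X → ⟦ nearEnd ℓ r X ⟧))  ≡⟨ *-left-comm ℓ (σ ^ (n ∸ ℓ)) _ ⟩
      σ ^ (n ∸ ℓ) * (ℓ * Sum ℓ (λ X → ⟦ nearEnd ℓ r X ⟧))  ≤⟨ *-monoʳ-≤ (σ ^ (n ∸ ℓ)) (nearEnd-count ℓ r 0<ℓ 2r≤ℓ) ⟩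
      σ ^ (n ∸ ℓ) * (r * (2 * σ ^ ℓ))                      ≡⟨ regroup r (σ ^ (n ∸ ℓ)) (σ ^ ℓ) ⟩
      2 * (r * (σ ^ (n ∸ ℓ) * σ ^ ℓ))                      ≡⟨ cong (λ k → 2 * (r * k)) (^[n∸m]*^m≡^n σ (≤-trans (m≤n+m ℓ i) i+ℓ≤n)) ⟩
      2 * (r * σ ^ n)                                      ∎
      where
      regroup : ∀ r x y → x * (r * (2 * y)) ≡ 2 * (r * (x * y))
      regroup = solve-∀

  module _ (r m : ℕ) (m<σ^r : suc m ≤ σ ^ r) where

    open BlockMinima r m

    leftBlockMin-count : ∀ n p → suc m * Sum n (λ T → ⟦ leftBlockMin p T ⟧) ≤ 2 * σ ^ n
    leftBlockMin-count n p with m * r ≤? p | p + r ≤? n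
    ... | no mr≰p | _ = Sum-zero-≤ n (suc m) _ (λ T _ → ⟦false∧⟧ _ (dec-false (m * r ≤? p) mr≰p))
    ... | yes mr≤p | no p+r≰n = Sum-zero-≤ n (suc m) _ (λ T (|T| , _) → n≤0⇒n≡0 (≤-trans (⟦∧⟧≤ (does (m * r ≤? p)) _)
          (≤-reflexive (⟦false∧⟧ _ (dec-false (p + r ≤? length T) (λ p+r≤T → p+r≰n (subst (p + r ≤_) |T| p+r≤T)))))))
    ... | yes mr≤p | yes p+r≤n = Sum-window-≤ n s (m * r + r) (suc m) _ g s+L≤n
          (λ T _ → ≤-trans (⟦∧∧⟧≤ (does (m * r ≤? p)) (does (p + r ≤? length T)) _) (≤-reflexive (in-window T)))
          (subst (λ k → suc m * k ≤ 2 * σ ^ (m * r + r)) (sym Sum-g) (minBlockCount-≤ r m m<σ^r))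
      where
      s = p ∸ m * r
      s+mr≡p = m∸n+n≡m mr≤p
      s+L≤n : s + (m * r + r) ≤ n
      s+L≤n = ≤-trans (≤-reflexive (trans (sym (+-assoc s (m * r) r)) (cong (_+ r) s+mr≡p))) p+r≤n
      g : List ℕ → ℕ
      g seg = ⟦ blocks≥ r (drop (m * r) seg) m (take (m * r) seg) ⟧
      in-window : ∀ T → ⟦ blocks≥ r (block T p) m (take (m * r) (drop s T)) ⟧ ≡ g (take (m * r + r) (drop s T))
      in-window T = cong₂ (λ x ys → ⟦ blocks≥ r x m ys ⟧)
        (begin
          take r (drop p T)                             ≡⟨ cong (λ k → take r (drop k T)) s+mr≡p ⟨
          take r (drop (s + m * r) T)                   ≡⟨ cong (take r) (drop-drop s (m * r) T) ⟨
          take r (drop (m * r) (drop s T))              ≡⟨ take-drop r (m * r) (drop s T) ⟩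
          drop (m * r) (take (m * r + r) (drop s T))    ∎)
        (sym (take-take-≤ (m * r) (m * r + r) (drop s T) (m≤m+n (m * r) r)))
        where open ≡-Reasoning
      Sum-g : Sum (m * r + r) g ≡ minBlockCount r m
      Sum-g = trans (Sum-++ (m * r) r g)
             (trans (Sum-cong (m * r) (λ ys (|ys| , _) → Sum-cong r (λ x _ →
                       cong₂ (λ x′ ys′ → ⟦ blocks≥ r x′ m ys′ ⟧) (drop-++-exact ys x |ys|) (take-++-exact ys x |ys|))))
                    (Sum-swap (m * r) r (λ ys x → ⟦ blocks≥ r x m ys ⟧)))

    rightBlockMin-count : ∀ n p → suc m * Sum n (λ T → ⟦ rightBlockMin p T ⟧) ≤ 2 * σ ^ n
    rightBlockMin-count n p with p + r + m * r ≤? n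
    ... | no p+r+mr≰n = Sum-zero-≤ n (suc m) _ (λ T (|T| , _) → ⟦false∧⟧ _
          (dec-false (p + r + m * r ≤? length T) (λ p+r+mr≤T → p+r+mr≰n (subst (p + r + m * r ≤_) |T| p+r+mr≤T))))
    ... | yes p+r+mr≤n = Sum-window-≤ n p (r + m * r) (suc m) _ g p+L≤n
          (λ T _ → ≤-trans (⟦∧⟧≤ (does (p + r + m * r ≤? length T)) _) (≤-reflexive (in-window T)))
          (subst₂ (λ k l → suc m * k ≤ 2 * σ ^ l) (sym Sum-g) (+-comm (m * r) r) (minBlockCount-≤ r m m<σ^r))
      where
      p+L≤n : p + (r + m * r) ≤ n
      p+L≤n = ≤-trans (≤-reflexive (sym (+-assoc p r (m * r)))) p+r+mr≤n
      g : List ℕ → ℕ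
      g seg = ⟦ blocks≥ r (take r seg) m (drop r seg) ⟧
      in-window : ∀ T → ⟦ blocks≥ r (block T p) m (take (m * r) (drop (p + r) T)) ⟧ ≡ g (take (r + m * r) (drop p T))
      in-window T = cong₂ (λ x ys → ⟦ blocks≥ r x m ys ⟧)
        (sym (take-take-≤ r (r + m * r) (drop p T) (m≤m+n r (m * r))))
        (begin
          take (m * r) (drop (p + r) T)                 ≡⟨ cong (take (m * r)) (drop-drop p r T) ⟨
          take (m * r) (drop r (drop p T))              ≡⟨ take-drop (m * r) r (drop p T) ⟩
          drop r (take (r + m * r) (drop p T))          ∎)
        where open ≡-Reasoning
      Sum-g : Sum (r + m * r) g ≡ minBlockCount r m
      Sum-g = trans (Sum-++ r (m * r) g)
                    (Sum-cong r (λ x (|x| , _) → Sum-cong (m * r) (λ ys _ →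
                       cong₂ (λ x′ ys′ → ⟦ blocks≥ r x′ m ys′ ⟧) (take-++-exact x ys |x|) (drop-++-exact x ys |x|))))

    blockMin-part : ∀ n ℓ → ℓ ≤ 4 * r * suc m →
      ℓ * Sum n (λ T → ∑[ p < length T ] ⟦ leftBlockMin p T ⟧ + ⟦ rightBlockMin p T ⟧) ≤ n * (16 * (r * σ ^ n))
    blockMin-part n ℓ ℓ≤4r[1+m] = begin
      ℓ * Sum n (λ T → ∑[ p < length T ] B p T)
        ≡⟨ cong (ℓ *_) (Sum-cong n (λ T (|T| , _) → cong (λ k → ∑[ p < k ] B p T) |T|)) ⟩
      ℓ * Sum n (λ T → ∑[ p < n ] B p T)
        ≡⟨ cong (ℓ *_) (Sum-sumTo n n B) ⟩
      ℓ * (∑[ p < n ] Sum n (B p))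
        ≡⟨ sumTo-*ˡ n ℓ _ ⟨
      ∑[ p < n ] ℓ * Sum n (B p)
        ≤⟨ sumTo-mono-≤ n (λ p _ → per-position p) ⟩
      ∑[ p < n ] 16 * (r * σ ^ n)
        ≡⟨ sumTo-const n _ ⟩
      n * (16 * (r * σ ^ n)) ∎
      where
      open ≤-Reasoning
      B : ℕ → List ℕ → ℕ
      B p T = ⟦ leftBlockMin p T ⟧ + ⟦ rightBlockMin p T ⟧
      per-position : ∀ p → ℓ * Sum n (B p) ≤ 16 * (r * σ ^ n)
      per-position p = begin
        ℓ * Sum n (B p)                      ≡⟨ cong (ℓ *_) (Sum-+ n _ _) ⟩
        ℓ * (SL + SR)                        ≤⟨ *-monoˡ-≤ (SL + SR) ℓ≤4r[1+m] ⟩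
        4 * r * suc m * (SL + SR)            ≡⟨ distribute r (suc m) SL SR ⟩
        4 * r * (suc m * SL + suc m * SR)    ≤⟨ *-monoʳ-≤ (4 * r) (+-mono-≤ (leftBlockMin-count n p) (rightBlockMin-count n p)) ⟩
        4 * r * (2 * σ ^ n + 2 * σ ^ n)      ≡⟨ collect r (σ ^ n) ⟩
        16 * (r * σ ^ n)                     ∎
        where
        SL = Sum n (λ T → ⟦ leftBlockMin p T ⟧)
        SR = Sum n (λ T → ⟦ rightBlockMin p T ⟧)
        distribute : ∀ r q a b → 4 * r * q * (a + b) ≡ 4 * r * (q * a + q * b)
        distribute = solve-∀
        collect : ∀ r s → 4 * r * (2 * s + 2 * s) ≡ 16 * (r * s)
        collect = solve-∀

    ℓ*Sum-anchorSetSize≤′ : ∀ n ℓ → 0 < r → suc m * (2 * r) ≤ ℓ → ℓ ≤ 4 * r * suc m →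
      ℓ * Sum n (anchorSetSize ℓ) ≤ n * (18 * (r * σ ^ n))
    ℓ*Sum-anchorSetSize≤′ n ℓ 0<r [1+m]2r≤ℓ ℓ≤4r[1+m] = begin
      ℓ * Sum n (anchorSetSize ℓ)
        ≤⟨ *-monoʳ-≤ ℓ (Sum-mono-≤ n (λ T _ → anchorSetSize-≤ ℓ T 0<r 2mr+r≤ℓ)) ⟩
      ℓ * Sum n (λ T → BM T + NE T)
        ≡⟨ trans (cong (ℓ *_) (Sum-+ n BM NE)) (*-distribˡ-+ ℓ (Sum n BM) (Sum n NE)) ⟩
      ℓ * Sum n BM + ℓ * Sum n NE
        ≤⟨ +-mono-≤ (blockMin-part n ℓ ℓ≤4r[1+m]) (nearEnd-part n ℓ r 0<ℓ 2r≤ℓ) ⟩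
      n * (16 * (r * σ ^ n)) + n * (2 * (r * σ ^ n))
        ≡⟨ collect n (r * σ ^ n) ⟩
      n * (18 * (r * σ ^ n)) ∎
      where
      open ≤-Reasoning
      BM NE : List ℕ → ℕ
      BM T = ∑[ p < length T ] ⟦ leftBlockMin p T ⟧ + ⟦ rightBlockMin p T ⟧
      NE T = ∑[ i < suc (length T) ∸ ℓ ] ⟦ nearEnd ℓ r (take ℓ (drop i T)) ⟧
      2r≤ℓ : 2 * r ≤ ℓ
      2r≤ℓ = ≤-trans (m≤m+n (2 * r) _) [1+m]2r≤ℓ
      0<ℓ : 0 < ℓ
      0<ℓ = <-≤-trans 0<r (≤-trans (m≤m+n r (r + 0)) 2r≤ℓ)
      2mr+r≤ℓ : m * r + m * r + r ≤ ℓ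
      2mr+r≤ℓ = ≤-trans (m≤m+n _ r) (≤-trans (≤-reflexive (expand m r)) [1+m]2r≤ℓ)
        where
        expand : ∀ m r → m * r + m * r + r + r ≡ suc m * (2 * r)
        expand = solve-∀
      collect : ∀ n x → n * (16 * x) + n * (2 * x) ≡ n * (18 * x)
      collect = solve-∀

-- Choosing the block length

quotient-bounds : ∀ a b → 0 < b → ∃[ q ] q * b ≤ a × a < suc q * b
quotient-bounds a b 0<b = a / b , m/n*n≤m a b , (begin-strict
  a                  ≡⟨ m≡m%n+[m/n]*n a b ⟩
  a % b + a / b * b  <⟨ +-monoˡ-< (a / b * b) (m%n<n a b) ⟩
  b + a / b * b      ∎)
  where
  open ≤-Reasoning
  instance
    b≢0 : NonZero b
    b≢0 = >-nonZero 0<b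

<2^suc⌊log₂⌋ : ∀ n → n < 2 ^ suc ⌊log₂ n ⌋
<2^suc⌊log₂⌋ n with n <? 2 ^ suc ⌊log₂ n ⌋
... | yes n<2^ = n<2^
... | no  n≮2^ = ⊥-elim (<-irrefl refl (begin-strict
  ⌊log₂ n ⌋                    <⟨ n<1+n _ ⟩
  suc ⌊log₂ n ⌋                ≡⟨ ⌊log₂[2^n]⌋≡n (suc ⌊log₂ n ⌋) ⟨
  ⌊log₂ (2 ^ suc ⌊log₂ n ⌋) ⌋  ≤⟨ ⌊log₂⌋-mono-≤ (≮⇒≥ n≮2^) ⟩
  ⌊log₂ n ⌋                    ∎))
  where open ≤-Reasoning

0<⌊log₂⌋ : ∀ {n} → 2 ≤ n → 0 < ⌊log₂ n ⌋
0<⌊log₂⌋ {n} 2≤n = subst (_≤ ⌊log₂ n ⌋) (⌊log₂[2^n]⌋≡n 1) (⌊log₂⌋-mono-≤ 2≤n)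

2^⌊log₂⌋≤ : ∀ n → 0 < n → 2 ^ ⌊log₂ n ⌋ ≤ n
2^⌊log₂⌋≤ n = go n (<-wellFounded n)
  where
  go : ∀ n → Acc _<_ n → 0 < n → 2 ^ ⌊log₂ n ⌋ ≤ n
  go (suc zero)    _        _ = ≤-refl
  go n@(suc (suc k)) (acc rs) _ = begin
    2 ^ ⌊log₂ n ⌋                 ≡⟨ cong (2 ^_) (m+[n∸m]≡n 1≤⌊log₂n⌋) ⟨
    2 * 2 ^ (⌊log₂ n ⌋ ∸ 1)       ≡⟨ cong (λ e → 2 * 2 ^ e) (⌊log₂⌊n/2⌋⌋≡⌊log₂n⌋∸1 n) ⟨
    2 * 2 ^ ⌊log₂ ⌊ n /2⌋ ⌋       ≤⟨ *-monoʳ-≤ 2 (go ⌊ n /2⌋ (rs (⌊n/2⌋<n (suc k))) (⌊n/2⌋-mono {2} {n} (s≤s (s≤s z≤n)))) ⟩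
    2 * ⌊ n /2⌋                   ≡⟨ cong (⌊ n /2⌋ +_) (+-identityʳ ⌊ n /2⌋) ⟩
    ⌊ n /2⌋ + ⌊ n /2⌋             ≤⟨ +-monoʳ-≤ ⌊ n /2⌋ (⌊n/2⌋≤⌈n/2⌉ n) ⟩
    ⌊ n /2⌋ + ⌈ n /2⌉             ≡⟨ ⌊n/2⌋+⌈n/2⌉≡n n ⟩
    n                             ∎
    where
    open ≤-Reasoning
    1≤⌊log₂n⌋ = 0<⌊log₂⌋ {n} (s≤s (s≤s z≤n))

-- The witness is r = 1 + ⌊log₂ ℓ⌋ / ⌊log₂ σ⌋.
block-length : ∀ σ ℓ → 2 ≤ σ → ∃[ r ] 0 < r × ℓ < σ ^ r × r * ⌊log₂ σ ⌋ ≤ ⌊log₂ ℓ ⌋ + ⌊log₂ σ ⌋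
block-length σ ℓ 2≤σ with quotient-bounds ⌊log₂ ℓ ⌋ ⌊log₂ σ ⌋ (0<⌊log₂⌋ 2≤σ)
... | q , q*Lσ≤Lℓ , Lℓ<[1+q]Lσ = suc q , z<s , ℓ<σ^r , ≤-trans (+-monoʳ-≤ ⌊log₂ σ ⌋ q*Lσ≤Lℓ) (≤-reflexive (+-comm ⌊log₂ σ ⌋ _))
  where
  open ≤-Reasoning
  ℓ<σ^r : ℓ < σ ^ suc q
  ℓ<σ^r = begin-strict
    ℓ                          <⟨ <2^suc⌊log₂⌋ ℓ ⟩
    2 ^ suc ⌊log₂ ℓ ⌋          ≤⟨ ^-monoʳ-≤ 2 (subst (suc ⌊log₂ ℓ ⌋ ≤_) (*-comm (suc q) ⌊log₂ σ ⌋) Lℓ<[1+q]Lσ) ⟩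
    2 ^ (⌊log₂ σ ⌋ * suc q)    ≡⟨ ^-*-assoc 2 ⌊log₂ σ ⌋ (suc q) ⟨
    (2 ^ ⌊log₂ σ ⌋) ^ suc q    ≤⟨ ^-monoˡ-≤ (suc q) (2^⌊log₂⌋≤ σ (<-≤-trans z<s 2≤σ)) ⟩
    σ ^ suc q                  ∎

ℓ*Sum-anchorSetSize≤ : ∀ σ n ℓ r → 0 < ℓ → 0 < r → ℓ < σ ^ r → ℓ * Sum σ n (anchorSetSize ℓ) ≤ n * (18 * (r * σ ^ n))
ℓ*Sum-anchorSetSize≤ σ n ℓ r 0<ℓ 0<r ℓ<σ^r with 2 * r ≤? ℓ
... | no 2r≰ℓ = begin
  ℓ * Sum σ n (anchorSetSize ℓ)   ≤⟨ *-monoʳ-≤ ℓ (Sum-mono-≤ σ n (λ T (|T| , _) → subst (anchorSetSize ℓ T ≤_) |T| (anchorSetSize-≤-length ℓ T 0<ℓ))) ⟩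
  ℓ * Sum σ n (λ _ → n)           ≡⟨ cong (ℓ *_) (Sum-const σ n n) ⟩
  ℓ * (σ ^ n * n)                 ≤⟨ *-monoˡ-≤ (σ ^ n * n) (<⇒≤ (≰⇒> 2r≰ℓ)) ⟩
  2 * r * (σ ^ n * n)             ≤⟨ m≤m+n _ (16 * r * (σ ^ n * n)) ⟩
  2 * r * (σ ^ n * n) + 16 * r * (σ ^ n * n) ≡⟨ collect r (σ ^ n) n ⟩
  n * (18 * (r * σ ^ n))          ∎
  where
  open ≤-Reasoning
  collect : ∀ r s n → 2 * r * (s * n) + 16 * r * (s * n) ≡ n * (18 * (r * s))
  collect = solve-∀
... | yes 2r≤ℓ with quotient-bounds ℓ (2 * r) (<-≤-trans 0<r (m≤m+n r (r + 0)))
...   | zero  , _ , ℓ<2r = ⊥-elim (<-irrefl refl (<-≤-trans ℓ<2r (subst (_≤ ℓ) (sym (+-identityʳ (2 * r))) 2r≤ℓ)))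
...   | suc m , [1+m]2r≤ℓ , ℓ<[2+m]2r = ℓ*Sum-anchorSetSize≤′ σ r m m<σ^r n ℓ 0<r [1+m]2r≤ℓ ℓ≤4r[1+m]
  where
  m<σ^r : suc m ≤ σ ^ r
  m<σ^r = ≤-trans (m≤m*n (suc m) (2 * r) {{>-nonZero (<-≤-trans 0<r (m≤m+n r (r + 0)))}}) (≤-trans [1+m]2r≤ℓ (<⇒≤ ℓ<σ^r))
  ℓ≤4r[1+m] : ℓ ≤ 4 * r * suc m
  ℓ≤4r[1+m] = ≤-trans (<⇒≤ ℓ<[2+m]2r) (≤-trans (m≤m+n _ (m * (2 * r))) (≤-reflexive (regroup m r)))
    where
    regroup : ∀ m r → suc (suc m) * (2 * r) + m * (2 * r) ≡ 4 * r * suc m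
    regroup = solve-∀

lemma8 : ∃[ C ] ∀ (σ n ℓ : ℕ) → 2 ≤ σ → 0 < ℓ →
           totalAnchors σ n ℓ * ℓ * ⌊log₂ σ ⌋ ≤ C * σ ^ n * n * (⌊log₂ ℓ ⌋ + ⌊log₂ σ ⌋)
lemma8 = 18 , bound
  where
  bound : ∀ (σ n ℓ : ℕ) → 2 ≤ σ → 0 < ℓ →
          totalAnchors σ n ℓ * ℓ * ⌊log₂ σ ⌋ ≤ 18 * σ ^ n * n * (⌊log₂ ℓ ⌋ + ⌊log₂ σ ⌋)
  bound σ n ℓ 2≤σ 0<ℓ with block-length σ ℓ 2≤σ
  ... | r , 0<r , ℓ<σ^r , rLσ≤Lℓ+Lσ = begin
    totalAnchors σ n ℓ * ℓ * ⌊log₂ σ ⌋          ≡⟨ cong (λ z → z * ℓ * ⌊log₂ σ ⌋) (sum-allStrings σ n (anchorSetSize ℓ)) ⟩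
    Sum σ n (anchorSetSize ℓ) * ℓ * ⌊log₂ σ ⌋   ≡⟨ cong (_* ⌊log₂ σ ⌋) (*-comm (Sum σ n (anchorSetSize ℓ)) ℓ) ⟩
    ℓ * Sum σ n (anchorSetSize ℓ) * ⌊log₂ σ ⌋   ≤⟨ *-monoˡ-≤ ⌊log₂ σ ⌋ (ℓ*Sum-anchorSetSize≤ σ n ℓ r 0<ℓ 0<r ℓ<σ^r) ⟩
    n * (18 * (r * σ ^ n)) * ⌊log₂ σ ⌋          ≡⟨ regroup n r (σ ^ n) ⌊log₂ σ ⌋ ⟩
    18 * σ ^ n * n * (r * ⌊log₂ σ ⌋)            ≤⟨ *-monoʳ-≤ (18 * σ ^ n * n) rLσ≤Lℓ+Lσ ⟩
    18 * σ ^ n * n * (⌊log₂ ℓ ⌋ + ⌊log₂ σ ⌋)    ∎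
    where
    open ≤-Reasoning
    regroup : ∀ n r s L → n * (18 * (r * s)) * L ≡ 18 * s * n * (r * L)
    regroup = solve-∀
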